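{- Assume the set of critical numbers is nonempty and $l_1>l_1'$. For $t\in\frac{m+n}{2}+\mathbb{Z}$ put $s:=t+\frac{n-m}{2}-1\in\mathbb{Z}$. If $n,m$ are not both odd, then $t$ satisfies $|t-\kappa|<L+\frac12$ (hence is critical) if and only if $$\check\mu_{a_j}\ge\lambda_j-s\ge\check\mu_{1+a_j}\quad\text{for } j=1,\dots,m.\qquad (I_j)$$ If $n\equiv m\equiv1\bmod2$, then $t$ satisfies $|t-\kappa|<L+\frac12$ if and only if $s$ satisfies $(I_j)$ for all $j\ne\frac{m+1}{2}$ together with the middle condition $$\check\mu_{\frac{n-1}{2}}\ge\lambda_{\frac{m+1}{2}}-s\ge\check\mu_{\frac{n+3}{2}}-1\ \text{ if } k \text{ is even},\qquad \lambda_{\frac{m-1}{2}}\ge\check\mu_{\frac{n+1}{2}}+s\ge\lambda_{\frac{m+3}{2}}\ \text{ if } k \text{ is odd}.$$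
   Context: For $N\ge1$ let $L_0^+(N)$ be the set of $(w,l)\in\mathbb{Z}\times\mathbb{Z}^N$ with $l_1>\dots>l_N$, $l_i+l_{N+1-i}=0$ and $w+l_i\equiv N+1\bmod2$. Fix $n,m\ge1$, $(w,l)\in L_0^+(n)$, $(w',l')\in L_0^+(m)$, $\delta,\delta'\in\{0,1\}$. In Knapp's notation for $W_{\mathbb{R}}$, $(l,t)$ ($l\ge1$) is irreducible $2$-dimensional and $(\mathrm{sgn}^\epsilon,t)$ is $1$-dimensional, $L(s,(l,t))=\Gamma_{\mathbb{C}}(s+t+\frac l2)$, $L(s,(\mathrm{sgn}^\epsilon,t))=\Gamma_{\mathbb{R}}(s+t+\epsilon)$, $\Gamma_{\mathbb{R}}(s)=\pi^{ -s/2}\Gamma(s/2)$, $\Gamma_{\mathbb{C}}(s)=2(2\pi)^{ -s}\Gamma(s)$; multiplicative over constituents. $\pi_\infty^W=\bigoplus_{i\le n/2}(l_i,-w/2)$ plus $(\mathrm{sgn}^\delta,-w/2)$ if $n$ odd; $\sigma_\infty^W$ analogously; $\tau=\pi_\infty^W\otimes\sigma_\infty^W$. $t\in\frac{n+m}{2}+\mathbb{Z}$ is critical if neither $L(s,\tau)$ nor $L(1-s,\check\tau)$ has a pole at $s=t$. $\kappa=\frac12(w+w'+1)$; $L_0=\min\{|l_i-l'_j|:(i,j)\ne(\frac{n+1}{2},\frac{m+1}{2})\}$, $L=L_0/2$. Highest weights: $\mu_i=\frac{w+l_i+2i-1-n}{2}$, $\check\mu_i=-\mu_{n+1-i}$,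 $\nu_j=\frac{w'+l'_j+2j-1-m}{2}$. Position tuple: $a_j$ unique integer with $1\le a_j\le n-1$ and $l_{a_j}>l'_j\ge l_{1+a_j}$. A jump index is $j\in\{1,\dots,m-1\}$ with $a_j<a_{j+1}$; $k$ is the number of jump indices. $\lambda_j=\nu_j+a_j-j$. -}

module Defs where

open import Data.Nat as ℕ using (ℕ; zero; suc)
open import Data.Integer as ℤ using (ℤ; +_; -_; _+_; _-_; _*_; ∣_∣)
open import Data.Integer.Divisibility using (_∣_)
open import Data.Fin using (Fin; toℕ) renaming (zero to f0; suc to fs)
open import Data.List using (List; []; _∷_; _++_; concatMap; map; foldr; upTo)
open import Data.List.Relation.Unary.Any using (Any)
open import Data.Product using (Σ; ∃; _×_)
open import Relation.Nullary using (¬_; yes; no)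
open import Relation.Binary.PropositionalEquality using (_≡_; _≢_)

-- Conventions.
-- Finite tuples (l_1,...,l_N) are functions ℕ → ℤ read 1-indexed;
-- values outside 1..N are irrelevant junk.
-- Half-integers t are represented by their double T = 2t ∈ ℤ.

record InL0+ (N : ℕ) (w : ℤ) (l : ℕ → ℤ) : Set where
  field
    decreasing : ∀ i → 1 ℕ.≤ i → i ℕ.< N → l (suc i) ℤ.< l i
    symmetric  : ∀ i → 1 ℕ.≤ i → i ℕ.≤ N → l i + l (suc N ℕ.∸ i) ≡ + 0
    parity     : ∀ i → 1 ℕ.≤ i → i ℕ.≤ N → + 2 ∣ (w + l i - + suc N)

-- Irreducible representations of W_ℝ (Knapp), with doubled t:
--   two l T  is (l , T/2)          (2-dimensional, l ≥ 1)
--   one ε T  is (sgn^ε , T/2)      (1-dimensional)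
data WCon : Set where
  two : ℤ → ℤ → WCon
  one : Fin 2 → ℤ → WCon

WRep : Set
WRep = List WCon

xor2 : Fin 2 → Fin 2 → Fin 2
xor2 f0 e = e
xor2 (fs f0) f0 = fs f0
xor2 (fs f0) (fs f0) = f0

_⊗c_ : WCon → WCon → WRep
two l T ⊗c two l' T' with l ℤ.≟ l'
... | yes _ = two (l + l') (T + T') ∷ one f0 (T + T') ∷ one (fs f0) (T + T') ∷ []
... | no  _ = two (l + l') (T + T') ∷ two (+ ∣ l - l' ∣) (T + T') ∷ []
two l T ⊗c one ε T' = two l (T + T') ∷ []
one ε T ⊗c two l T' = two l (T + T') ∷ []
one ε T ⊗c one ε' T' = one (xor2 ε ε') (T + T') ∷ []

_⊗_ : WRep → WRep → WRep
ρ ⊗ σ = concatMap (λ c → concatMap (λ d → c ⊗c d) σ) ρ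

dualC : WCon → WCon
dualC (two l T) = two l (- T)
dualC (one ε T) = one ε (- T)

dual : WRep → WRep
dual = map dualC

-- L(s,(l,t)) = Γ_C(s+t+l/2) has a pole at s = X/2 iff s+t+l/2 ∈ {0,-1,-2,...};
-- L(s,(sgn^ε,t)) = Γ_R(s+t+ε) has a pole at s = X/2 iff s+t+ε ∈ {0,-2,-4,...}.
-- (Everything multiplied by 2.)
PoleC : WCon → ℤ → Set
PoleC (two l T) X = ∃ λ (k : ℕ) → X + T + l ≡ - (+ (2 ℕ.* k))
PoleC (one ε T) X = ∃ λ (k : ℕ) → X + T + + (2 ℕ.* toℕ ε) ≡ - (+ (4 ℕ.* k))

-- L(s,ρ) = product over constituents; Γ has no zeros, so L has a pole at
-- s = X/2 iff some constituent's factor does.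
HasPole : WRep → ℤ → Set
HasPole ρ X = Any (λ c → PoleC c X) ρ

piW : (n : ℕ) → ℤ → (ℕ → ℤ) → Fin 2 → WRep
piW n w l δ = map (λ i → two (l (suc i)) (- w)) (upTo (n ℕ./ 2))
              ++ oddPart (n ℕ.% 2)
  where
  oddPart : ℕ → WRep
  oddPart 1 = one δ (- w) ∷ []
  oddPart _ = []

Critical : (n m : ℕ) → WRep → ℤ → Set
Critical n m τ T =
  (+ 2 ∣ (T - + (n ℕ.+ m))) × ¬ HasPole τ T × ¬ HasPole (dual τ) (+ 2 - T)

minList : List ℕ → ℕ
minList [] = 0
minList (x ∷ xs) = foldr ℕ._⊓_ x xs

isMiddle : (n m i j : ℕ) → Set
isMiddle n m i j = (2 ℕ.* i ≡ suc n) × (2 ℕ.* j ≡ suc m)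

L0 : (n m : ℕ) → (ℕ → ℤ) → (ℕ → ℤ) → ℕ
L0 n m l l' = minList (concatMap (λ i → concatMap (λ j → entry (suc i) (suc j)) (upTo m)) (upTo n))
  where
  entry : ℕ → ℕ → List ℕ
  entry i j with (2 ℕ.* i) ℕ.≟ suc n | (2 ℕ.* j) ℕ.≟ suc m
  ... | yes _ | yes _ = []
  ... | _     | _     = ∣ l i - l' j ∣ ∷ []

half : ℤ → ℤ
half x = x ℤ./ + 2

μ : (n : ℕ) → ℤ → (ℕ → ℤ) → ℕ → ℤ
μ n w l i = half (w + l i + + (2 ℕ.* i) - + 1 - + n)

μˇ : (n : ℕ) → ℤ → (ℕ → ℤ) → ℕ → ℤ
μˇ n w l i = - μ n w l (suc n ℕ.∸ i)

ν : (m : ℕ) → ℤ → (ℕ → ℤ) → ℕ → ℤ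
ν = μ

IsPositionTuple : (n m : ℕ) → (ℕ → ℤ) → (ℕ → ℤ) → (ℕ → ℕ) → Set
IsPositionTuple n m l l' a =
  ∀ j → 1 ℕ.≤ j → j ℕ.≤ m →
    (1 ℕ.≤ a j) × (a j ℕ.≤ n ℕ.∸ 1) × (l' j ℤ.< l (a j)) × (l (suc (a j)) ℤ.≤ l' j)

jumps : (m : ℕ) → (ℕ → ℕ) → ℕ
jumps m a = foldr ℕ._+_ 0 (map (λ i → ind (suc i)) (upTo (m ℕ.∸ 1)))
  where
  ind : ℕ → ℕ
  ind j with a j ℕ.<? a (suc j)
  ... | yes _ = 1
  ... | no  _ = 0

λ' : (n m : ℕ) → ℤ → (ℕ → ℤ) → (ℕ → ℕ) → ℕ → ℤ
λ' n m w' l' a j = ν m w' l' j + + a j - + j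

I : (n m : ℕ) → ℤ → (ℕ → ℤ) → ℤ → (ℕ → ℤ) → (ℕ → ℕ) → ℤ → ℕ → Set
I n m w l w' l' a s j =
  (λ' n m w' l' a j - s ℤ.≤ μˇ n w l (a j)) × (μˇ n w l (suc (a j)) ℤ.≤ λ' n m w' l' a j - s)

Middle : (n m : ℕ) → ℤ → (ℕ → ℤ) → ℤ → (ℕ → ℤ) → (ℕ → ℕ) → ℤ → Set
Middle n m w l w' l' a s =
  (2 ∣ₙ jumps m a →
     (λ' n m w' l' a ((m ℕ.+ 1) ℕ./ 2) - s ℤ.≤ μˇ n w l ((n ℕ.∸ 1) ℕ./ 2))
     × (μˇ n w l ((n ℕ.+ 3) ℕ./ 2) - + 1 ℤ.≤ λ' n m w' l' a ((m ℕ.+ 1) ℕ./ 2) - s))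
  × (¬ (2 ∣ₙ jumps m a) →
     (μˇ n w l ((n ℕ.+ 1) ℕ./ 2) + s ℤ.≤ λ' n m w' l' a ((m ℕ.∸ 1) ℕ./ 2))
     × (λ' n m w' l' a ((m ℕ.+ 3) ℕ./ 2) ℤ.≤ μˇ n w l ((n ℕ.+ 1) ℕ./ 2) + s))
  where open import Data.Nat.Divisibility using () renaming (_∣_ to _∣ₙ_)

-- Write X = 2(t - κ) = T - (w + w' + 1).  The parity conditions of L_0^+ make X ± (l_i - l'_j)
-- odd, so |X| < L_0 + 1 says |X| < |l_i - l'_j| for every pair (i, j) off the middle; and a
-- critical number forces l_i ≠ l'_j there, since equal weights put sgn⁰ and sgn¹ at the same t,
-- whose Γ-factors have a pole at every integer in L(s) or in L(1 - s).  Doubled, (I_j) reads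
-- l'_j - l_{a_j} < X < l'_j - l_{a_j + 1}.  As l and l' are decreasing and odd under
-- i ↦ N + 1 - i, the position tuple satisfies a_{m+1-j} = n - a_j, so (I_j) and (I_{m+1-j})
-- together bound X by |l_i - l'_j| for every i, while the pairs (a_j, j), (a_j + 1, j) give back
-- (I_j).  For n = 2h + 1, m = 2g + 1 the middle column l'_{g+1} = 0 needs |X| < l_h: the middle
-- condition says exactly this when k is even, and |X| < l'_g when k is odd, which by the
-- symmetry of the jumps happens only if a_g = h, where l'_g < l_h.

module Submission where

open import Defs
open import Data.Nat as ℕ using (ℕ; suc)
open import Data.Integer as ℤ using (ℤ; +_; _+_; _-_; _*_; ∣_∣)
open import Data.Fin using (Fin; toℕ)
open import Data.Fin using () renaming (zero to zeroF; suc to sucF)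
open import Data.Product using (∃; _×_)
open import Relation.Nullary using (¬_)
open import Relation.Binary.PropositionalEquality using (_≡_; _≢_)
open import Function.Bundles using (_⇔_)

open import Data.Nat using (zero; z≤n; s≤s)
import Data.Nat.Properties as ℕP
import Data.Nat.DivMod as ℕD
open import Data.Integer using (-_; -[1+_]; 0ℤ; _≤_; _<_; +≤+; -≤+; -≤-)
import Data.Integer.Properties as ℤP
import Data.Integer.DivMod as ℤD
import Data.Integer.Divisibility.Signed as ℤDiv
open import Data.Integer.Tactic.RingSolver using (solve-∀)
open import Data.Product using (Σ; _,_; proj₁; proj₂; swap)
open import Data.Sum using (_⊎_; inj₁; inj₂)
open import Data.Empty using (⊥; ⊥-elim)
open import Relation.Binary.Definitions using (tri<; tri≈; tri>)
open import Relation.Binary.PropositionalEquality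
  using (refl; sym; trans; cong; cong₂; subst; subst₂; module ≡-Reasoning)
open import Function.Bundles using (mk⇔; Equivalence)
open import Data.Product.Function.NonDependent.Propositional using (_×-⇔_)
open import Function.Base using (id; _∘_)
open import Relation.Nullary using (Dec; yes; no)
open import Data.List using (List; []; _∷_; _∷ʳ_; concatMap; map; foldr; upTo; applyUpTo)
open import Data.List.Properties using (map-cong; map-upTo; applyUpTo-∷ʳ)
open import Data.Nat.ListAction using (sum)
open import Data.Nat.ListAction.Properties using (sum-++)
import Data.Nat.Tactic.RingSolver as ℕSolver
import Data.Nat.Divisibility as ℕDiv
open ℕDiv using () renaming (_∣_ to _∣ℕ_)
open import Data.List.Relation.Unary.Any using (here; there)
import Data.List.Relation.Unary.Any.Properties as Any
open import Data.List.Membership.Propositional using (_∈_; lose)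
open import Data.List.Membership.Propositional.Properties
  using (∈-concatMap⁺; ∈-concatMap⁻; ∈-++⁺ˡ; ∈-map⁺; ∈-upTo⁺)

odd≢even : ∀ a b → a * + 2 ≢ b * + 2 + + 1
odd≢even a b eq = 2*∣d∣≢1 ∣ a - b ∣ (trans (sym (ℤP.abs-* (a - b) (+ 2))) (cong ∣_∣ d*2≡1))
  where
  d*2≡1 : (a - b) * + 2 ≡ + 1
  d*2≡1 = trans (distrib a b) (trans (cong (_- b * + 2) eq) (cancel b))
    where
    distrib : ∀ a b → (a - b) * + 2 ≡ a * + 2 - b * + 2
    distrib = solve-∀
    cancel : ∀ b → b * + 2 + + 1 - b * + 2 ≡ + 1
    cancel = solve-∀
  2*∣d∣≢1 : ∀ k → k ℕ.* 2 ≢ 1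
  2*∣d∣≢1 zero ()
  2*∣d∣≢1 (suc k) ()

half-*2 : ∀ k → half (k * + 2) ≡ k
half-*2 k with (k * + 2) ℤD.% + 2 | ℤD.a≡a%n+[a/n]*n (k * + 2) (+ 2) | ℤD.n%d<d (k * + 2) (+ 2)
... | 0 | eq | _ = ℤP.*-cancelʳ-≡ (half (k * + 2)) k (+ 2) (trans (sym (ℤP.+-identityˡ _)) (sym eq))
... | 1 | eq | _ = ⊥-elim (odd≢even k (half (k * + 2)) (trans eq (ℤP.+-comm (+ 1) (half (k * + 2) * + 2))))
... | suc (suc _) | _ | s≤s (s≤s ())

double-half : ∀ {e} k → e ≡ k * + 2 → + 2 * half e ≡ e
double-half k refl = trans (cong (+ 2 *_) (half-*2 k)) (ℤP.*-comm (+ 2) k)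

<⇒0≤j-i-1 : ∀ {i j} → i < j → 0ℤ ≤ j - i - + 1
<⇒0≤j-i-1 {i} {j} i<j = subst (0ℤ ≤_) (shift i j) (ℤP.i≤j⇒0≤j-i (ℤP.i<j⇒suc[i]≤j i<j))
  where shift : ∀ i j → j - (+ 1 + i) ≡ j - i - + 1
        shift = solve-∀

0≤j-i-1⇒< : ∀ {i j} → 0ℤ ≤ j - i - + 1 → i < j
0≤j-i-1⇒< {i} {j} 0≤ = ℤP.suc[i]≤j⇒i<j (ℤP.0≤i-j⇒j≤i (subst (0ℤ ≤_) (shift i j) 0≤))
  where shift : ∀ i j → j - i - + 1 ≡ j - (+ 1 + i)
        shift = solve-∀

-- μˇ, λ and s are halves of expressions in l, l' and X; this compares them after doubling.
≤⇔<-halving : ∀ u v y x → + 2 * (v - u) ≡ x - y - + 1 → (u ≤ v ⇔ y < x)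
≤⇔<-halving u v y x eq = mk⇔
  (λ u≤v → 0≤j-i-1⇒< (subst (0ℤ ≤_) eq (ℤP.*-monoˡ-≤-nonNeg (+ 2) (ℤP.i≤j⇒0≤j-i u≤v))))
  (λ y<x → ℤP.0≤i-j⇒j≤i (ℤP.*-cancelˡ-≤-pos 0ℤ (v - u) (+ 2) (subst (0ℤ ≤_) (sym eq) (<⇒0≤j-i-1 y<x))))

i+j≡0⇒j≡-i : ∀ i j → i + j ≡ 0ℤ → j ≡ - i
i+j≡0⇒j≡-i i j eq = trans (shift i j) (trans (cong (_- i) eq) (ℤP.+-identityˡ (- i)))
  where shift : ∀ i j → j ≡ (i + j) - i
        shift = solve-∀

-i<i⇒0<i : ∀ i → - i < i → 0ℤ < i
-i<i⇒0<i i -i<i with ℤP.≤-total i 0ℤ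
... | inj₂ 0≤i = ℤP.≤∧≢⇒< 0≤i (λ { refl → ℤP.<-irrefl refl -i<i })
... | inj₁ i≤0 = ⊥-elim (ℤP.<-irrefl refl (ℤP.<-≤-trans -i<i (ℤP.≤-trans i≤0 (ℤP.neg-mono-≤ i≤0))))

i<-i⇒i<0 : ∀ i → i < - i → i < 0ℤ
i<-i⇒i<0 i i<-i = subst (_< 0ℤ) (ℤP.neg-involutive i)
  (ℤP.neg-mono-< (-i<i⇒0<i (- i) (subst (_< - i) (sym (ℤP.neg-involutive i)) i<-i)))

-- Sequences in L_0^+(N)

module L0⁺ {N : ℕ} {w : ℤ} {l : ℕ → ℤ} (H : InL0+ N w l) where
  open InL0+ H

  decreasing-< : ∀ {i j} → 1 ℕ.≤ i → i ℕ.< j → j ℕ.≤ N → l j < l i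
  decreasing-< {i} {suc j} 1≤i (s≤s i≤j) j<N with ℕP.m≤n⇒m<n∨m≡n i≤j
  ... | inj₂ refl = decreasing i 1≤i j<N
  ... | inj₁ i<j  = ℤP.<-trans (decreasing j (ℕP.≤-trans 1≤i (ℕP.<⇒≤ i<j)) j<N)
                               (decreasing-< 1≤i i<j (ℕP.<⇒≤ j<N))

  decreasing-≤ : ∀ {i j} → 1 ℕ.≤ i → i ℕ.≤ j → j ℕ.≤ N → l j ≤ l i
  decreasing-≤ 1≤i i≤j j≤N with ℕP.m≤n⇒m<n∨m≡n i≤j
  ... | inj₂ refl = ℤP.≤-refl
  ... | inj₁ i<j  = ℤP.<⇒≤ (decreasing-< 1≤i i<j j≤N)

  mirror : ℕ → ℕ
  mirror i = suc N ℕ.∸ i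

  mirror-suc : ∀ {i} → i ℕ.≤ N → mirror i ≡ suc (N ℕ.∸ i)
  mirror-suc = ℕP.+-∸-assoc 1

  1≤mirror : ∀ {i} → i ℕ.≤ N → 1 ℕ.≤ mirror i
  1≤mirror i≤N = subst (1 ℕ.≤_) (sym (mirror-suc i≤N)) (s≤s z≤n)

  mirror≤N : ∀ {i} → 1 ℕ.≤ i → mirror i ℕ.≤ N
  mirror≤N 1≤i = ℕP.∸-monoʳ-≤ (suc N) 1≤i

  mirror-involutive : ∀ {i} → i ℕ.≤ N → mirror (mirror i) ≡ i
  mirror-involutive i≤N = ℕP.m∸[m∸n]≡n (ℕP.m≤n⇒m≤1+n i≤N)

  2*mirror≤N : ∀ {i} → suc N ℕ.< 2 ℕ.* i → 2 ℕ.* mirror i ℕ.≤ N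
  2*mirror≤N {i} N+1<2i = subst (ℕ._≤ N) (sym (ℕP.*-distribˡ-∸ 2 (suc N) i))
    (ℕP.m≤n+o⇒m∸n≤o (2 ℕ.* suc N) (2 ℕ.* i) (subst (ℕ._≤ 2 ℕ.* i ℕ.+ N) (double N) (ℕP.+-monoˡ-≤ N N+1<2i)))
    where double : ∀ N → suc (suc N) ℕ.+ N ≡ 2 ℕ.* suc N
          double = ℕSolver.solve-∀

  l-mirror : ∀ {i} → 1 ℕ.≤ i → i ℕ.≤ N → l (mirror i) ≡ - l i
  l-mirror 1≤i i≤N = i+j≡0⇒j≡-i _ _ (symmetric _ 1≤i i≤N)

  0<l : ∀ {i} → 1 ℕ.≤ i → 2 ℕ.* i ℕ.≤ N → 0ℤ < l i
  0<l {i} 1≤i 2i≤N = -i<i⇒0<i (l i) (subst (_< l i) (l-mirror 1≤i i≤N) l[mirror]<l)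
    where
    i+i≤N : i ℕ.+ i ℕ.≤ N
    i+i≤N = subst (λ k → i ℕ.+ k ℕ.≤ N) (ℕP.+-identityʳ i) 2i≤N
    i≤N : i ℕ.≤ N
    i≤N = ℕP.≤-trans (ℕP.m≤m+n i i) i+i≤N
    l[mirror]<l : l (mirror i) < l i
    l[mirror]<l = decreasing-< 1≤i (subst (i ℕ.<_) (sym (mirror-suc i≤N)) (s≤s (ℕP.m+n≤o⇒m≤o∸n i i+i≤N)))
                               (mirror≤N 1≤i)

  l<0 : ∀ {i} → i ℕ.≤ N → suc N ℕ.< 2 ℕ.* i → l i < 0ℤ
  l<0 {suc i} i≤N N<2i = i<-i⇒i<0 (l (suc i)) (subst (l (suc i) <_) (l-mirror (s≤s z≤n) i≤N) l<l[mirror])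
    where
    l<l[mirror] : l (suc i) < l (mirror (suc i))
    l<l[mirror] = decreasing-< (1≤mirror i≤N)
      (ℕP.m<n+o⇒m∸n<o (suc N) (suc i) (subst (λ k → suc N ℕ.< suc i ℕ.+ k) (ℕP.+-identityʳ (suc i)) N<2i))
      i≤N

  l≡0 : ∀ {i} → 2 ℕ.* i ≡ suc N → l i ≡ 0ℤ
  l≡0 {zero} ()
  l≡0 {suc i} 2i≡N+1 = ℤP.*-cancelʳ-≡ (l (suc i)) 0ℤ (+ 2)
      (trans (sym (double (l (suc i))))
             (trans (cong (λ k → l (suc i) + l k) (sym mirror≡i)) (symmetric (suc i) (s≤s z≤n) i≤N)))
    where
    double : ∀ x → x + x ≡ x * + 2
    double = solve-∀
    i+i≡N+1 : suc i ℕ.+ suc i ≡ suc N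
    i+i≡N+1 = trans (cong (suc i ℕ.+_) (sym (ℕP.+-identityʳ (suc i)))) 2i≡N+1
    i≤N : suc i ℕ.≤ N
    i≤N = ℕP.≤-pred (subst (suc i ℕ.<_) i+i≡N+1 (ℕP.m<m+n (suc i) (s≤s z≤n)))
    mirror≡i : mirror (suc i) ≡ suc i
    mirror≡i = trans (cong (ℕ._∸ suc i) (sym i+i≡N+1)) (ℕP.m+n∸m≡n (suc i) (suc i))

  position-unique : ∀ {p q} (y : ℤ) → 1 ℕ.≤ p → suc p ℕ.≤ N → 1 ℕ.≤ q → suc q ℕ.≤ N →
    y < l p → l (suc p) ≤ y → y < l q → l (suc q) ≤ y → p ≡ q
  position-unique {p} {q} y 1≤p p<N 1≤q q<N y<lp lp+1≤y y<lq lq+1≤y with ℕP.<-cmp p q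
  ... | tri≈ _ p≡q _ = p≡q
  ... | tri< p<q _ _ = ⊥-elim (ℤP.<-irrefl refl
        (ℤP.<-≤-trans y<lq (ℤP.≤-trans (decreasing-≤ (s≤s z≤n) p<q (ℕP.<⇒≤ q<N)) lp+1≤y)))
  ... | tri> _ _ q<p = ⊥-elim (ℤP.<-irrefl refl
        (ℤP.<-≤-trans y<lp (ℤP.≤-trans (decreasing-≤ (s≤s z≤n) q<p (ℕP.<⇒≤ p<N)) lq+1≤y)))

  weight-parity : ∀ {i} → 1 ℕ.≤ i → i ℕ.≤ N → Σ ℤ λ q → w + l i - + suc N ≡ q * + 2
  weight-parity {i} 1≤i i≤N with ℤDiv.∣ᵤ⇒∣ (parity i 1≤i i≤N)
  ... | ℤDiv.divides q eq = q , eq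

  double-μ : ∀ {i} → 1 ℕ.≤ i → i ℕ.≤ N → + 2 * μ N w l i ≡ w + l i + + 2 * + i - + 1 - + N
  double-μ {i} 1≤i i≤N = trans (double-half (q + + i) even) (cong (λ k → w + l i + k - + 1 - + N) (ℤP.pos-* 2 i))
    where
    q : ℤ
    q = proj₁ (weight-parity 1≤i i≤N)
    regroup : ∀ w l i N → w + l + + 2 * i - + 1 - N ≡ (w + l - (+ 1 + N)) + i * + 2
    regroup = solve-∀
    collect : ∀ q i → q * + 2 + i * + 2 ≡ (q + i) * + 2
    collect = solve-∀
    even : w + l i + + (2 ℕ.* i) - + 1 - + N ≡ (q + + i) * + 2
    even = trans (cong (λ k → w + l i + k - + 1 - + N) (ℤP.pos-* 2 i))
           (trans (regroup w (l i) (+ i) (+ N))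
           (trans (cong (_+ + i * + 2) (proj₂ (weight-parity 1≤i i≤N))) (collect q (+ i))))

  double-μˇ : ∀ {i} → 1 ℕ.≤ i → i ℕ.≤ N → + 2 * μˇ N w l i ≡ l i - w - + N - + 1 + + 2 * + i
  double-μˇ {i} 1≤i i≤N = begin
    + 2 * (- μ N w l (mirror i))
      ≡⟨ ℤP.neg-distribʳ-* (+ 2) _ ⟨
    - (+ 2 * μ N w l (mirror i))
      ≡⟨ cong -_ (double-μ (1≤mirror i≤N) (mirror≤N 1≤i)) ⟩
    - (w + l (mirror i) + + 2 * + mirror i - + 1 - + N)
      ≡⟨ cong₂ (λ x k → - (w + x + + 2 * k - + 1 - + N)) (l-mirror 1≤i i≤N) mirror-ℤ ⟩
    - (w + - l i + + 2 * (+ 1 + + N - + i) - + 1 - + N)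
      ≡⟨ simplify w (l i) (+ i) (+ N) ⟩
    l i - w - + N - + 1 + + 2 * + i ∎
    where
    open ≡-Reasoning
    mirror-ℤ : + mirror i ≡ + 1 + + N - + i
    mirror-ℤ = trans (sym (ℤP.⊖-≥ (ℕP.m≤n⇒m≤1+n i≤N))) (sym (ℤP.m-n≡m⊖n (suc N) i))
    simplify : ∀ w l i N → - (w + - l + + 2 * (+ 1 + N - i) - + 1 - N) ≡ l - w - N - + 1 + + 2 * i
    simplify = solve-∀

foldr-⊓-≤-seed : ∀ x ys → foldr ℕ._⊓_ x ys ℕ.≤ x
foldr-⊓-≤-seed x [] = ℕP.≤-refl
foldr-⊓-≤-seed x (y ∷ ys) = ℕP.≤-trans (ℕP.m⊓n≤n y _) (foldr-⊓-≤-seed x ys)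

foldr-⊓-≤-elem : ∀ x {y ys} → y ∈ ys → foldr ℕ._⊓_ x ys ℕ.≤ y
foldr-⊓-≤-elem x {ys = y ∷ ys} (here refl) = ℕP.m⊓n≤m y _
foldr-⊓-≤-elem x {ys = z ∷ ys} (there y∈ys) = ℕP.≤-trans (ℕP.m⊓n≤n z _) (foldr-⊓-≤-elem x y∈ys)

foldr-⊓-greatest : ∀ {k} x ys → k ℕ.≤ x → (∀ {y} → y ∈ ys → k ℕ.≤ y) → k ℕ.≤ foldr ℕ._⊓_ x ys
foldr-⊓-greatest x [] k≤x k≤ys = k≤x
foldr-⊓-greatest x (y ∷ ys) k≤x k≤ys =
  ℕP.⊓-glb (k≤ys (here refl)) (foldr-⊓-greatest x ys k≤x (λ y∈ys → k≤ys (there y∈ys)))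

minList-≤ : ∀ {xs y} → y ∈ xs → minList xs ℕ.≤ y
minList-≤ {x ∷ xs} (here refl) = foldr-⊓-≤-seed x xs
minList-≤ {x ∷ xs} (there y∈xs) = foldr-⊓-≤-elem x y∈xs

minList-greatest : ∀ {xs k y} → y ∈ xs → (∀ {z} → z ∈ xs → k ℕ.≤ z) → k ℕ.≤ minList xs
minList-greatest {x ∷ xs} _ k≤xs = foldr-⊓-greatest x xs (k≤xs (here refl)) (λ z∈xs → k≤xs (there z∈xs))

InRange : ℕ → ℕ → Set
InRange N i = (1 ℕ.≤ i) × (i ℕ.≤ N)

ForAllPairs : ℕ → ℕ → (ℕ → ℕ → Set) → Set
ForAllPairs n m P = ∀ {i j} → InRange n i → InRange m j → ¬ isMiddle n m i j → P i j

-- The entries of L0 are computed by a function local to its definition; unification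
-- against refl names it.  Here entry i j is the entry for the pair (i + 1, j + 1).
L0-entries : ∀ n m l l' → Σ (ℕ → ℕ → List ℕ) λ entry →
  L0 n m l l' ≡ minList (concatMap (λ i → concatMap (entry i) (upTo m)) (upTo n))
L0-entries n m l l' = _ , refl

module _ (n m : ℕ) (l l' : ℕ → ℤ) where

  private
    entry : ℕ → ℕ → List ℕ
    entry = proj₁ (L0-entries n m l l')
    entries : List ℕ
    entries = concatMap (λ i → concatMap (entry i) (upTo m)) (upTo n)

  entry-middle : ∀ {i j} → isMiddle n m (suc i) (suc j) → entry i j ≡ []
  entry-middle {i} {j} (2i≡n+1 , 2j≡m+1) with (2 ℕ.* suc i) ℕ.≟ suc n | (2 ℕ.* suc j) ℕ.≟ suc m
  ... | yes _ | yes _ = refl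
  ... | no 2i≢n+1 | _ = ⊥-elim (2i≢n+1 2i≡n+1)
  ... | yes _ | no 2j≢m+1 = ⊥-elim (2j≢m+1 2j≡m+1)

  entry-offMiddle : ∀ {i j} → ¬ isMiddle n m (suc i) (suc j) → entry i j ≡ ∣ l (suc i) - l' (suc j) ∣ ∷ []
  entry-offMiddle {i} {j} ¬mid with (2 ℕ.* suc i) ℕ.≟ suc n | (2 ℕ.* suc j) ℕ.≟ suc m
  ... | yes 2i≡n+1 | yes 2j≡m+1 = ⊥-elim (¬mid (2i≡n+1 , 2j≡m+1))
  ... | yes _ | no _ = refl
  ... | no _  | yes _ = refl
  ... | no _  | no _ = refl

  ∈-entries⁺ : ∀ {i j} → InRange n i → InRange m j → ¬ isMiddle n m i j → ∣ l i - l' j ∣ ∈ entries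
  ∈-entries⁺ {suc i} {suc j} (_ , i≤n) (_ , j≤m) ¬mid =
    ∈-concatMap⁺ _ (Any.applyUpTo⁺ id (∈-concatMap⁺ _ (Any.applyUpTo⁺ id
      (subst (∣ l (suc i) - l' (suc j) ∣ ∈_) (sym (entry-offMiddle ¬mid)) (here refl)) j≤m)) i≤n)

  ∈-entries⁻ : ∀ {y} → y ∈ entries → ∃ λ i → ∃ λ j →
    InRange n i × InRange m j × ¬ isMiddle n m i j × y ≡ ∣ l i - l' j ∣
  ∈-entries⁻ {y} y∈ with Any.applyUpTo⁻ id (∈-concatMap⁻ _ y∈)
  ... | i , i<n , y∈row with Any.applyUpTo⁻ id (∈-concatMap⁻ _ y∈row)
  ... | j , j<m , y∈entry = suc i , suc j , (s≤s z≤n , i<n) , (s≤s z≤n , j<m) , ¬mid , y≡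
    where
    ¬mid : ¬ isMiddle n m (suc i) (suc j)
    ¬mid mid with subst (y ∈_) (entry-middle mid) y∈entry
    ... | ()
    y≡ : y ≡ ∣ l (suc i) - l' (suc j) ∣
    y≡ with subst (y ∈_) (entry-offMiddle ¬mid) y∈entry
    ... | here y≡ = y≡

  ≤L0⇔ : ∀ {k i₀ j₀} → InRange n i₀ → InRange m j₀ → ¬ isMiddle n m i₀ j₀ →
    (k ℕ.≤ L0 n m l l' ⇔ ForAllPairs n m (λ i j → k ℕ.≤ ∣ l i - l' j ∣))
  ≤L0⇔ {k} i₀∈ j₀∈ ¬mid₀ = mk⇔ k≤pairs k≤L0
    where
    k≤pairs : k ℕ.≤ L0 n m l l' → ForAllPairs n m (λ i j → k ℕ.≤ ∣ l i - l' j ∣)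
    k≤pairs k≤L0 i∈ j∈ ¬mid = ℕP.≤-trans k≤L0 (minList-≤ (∈-entries⁺ i∈ j∈ ¬mid))
    k≤entry : ForAllPairs n m (λ i j → k ℕ.≤ ∣ l i - l' j ∣) → ∀ {z} → z ∈ entries → k ℕ.≤ z
    k≤entry k≤all z∈ = k≤pair (∈-entries⁻ z∈)
      where
      k≤pair : ∀ {z} → (∃ λ i → ∃ λ j → InRange n i × InRange m j × ¬ isMiddle n m i j × z ≡ ∣ l i - l' j ∣) →
        k ℕ.≤ z
      k≤pair (_ , _ , i∈ , j∈ , ¬mid , refl) = k≤all i∈ j∈ ¬mid
    k≤L0 : ForAllPairs n m (λ i j → k ℕ.≤ ∣ l i - l' j ∣) → k ℕ.≤ L0 n m l l'
    k≤L0 k≤all = minList-greatest (∈-entries⁺ i₀∈ j₀∈ ¬mid₀) (k≤entry k≤all)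

-- Counting jumps

jumpAt : (ℕ → ℕ) → ℕ → ℕ
jumpAt a j with a j ℕ.<? a (suc j)
... | yes _ = 1
... | no  _ = 0

jumpAt-yes : ∀ a j → a j ℕ.< a (suc j) → jumpAt a j ≡ 1
jumpAt-yes a j jump with a j ℕ.<? a (suc j)
... | yes _ = refl
... | no ¬jump = ⊥-elim (¬jump jump)

jumpAt-cong : ∀ a j j' → (a j ℕ.< a (suc j)) ⇔ (a j' ℕ.< a (suc j')) → jumpAt a j ≡ jumpAt a j'
jumpAt-cong a j j' jump⇔ with a j ℕ.<? a (suc j) | a j' ℕ.<? a (suc j')
... | yes _ | yes _ = refl
... | no _ | no _ = refl
... | yes jump | no ¬jump' = ⊥-elim (¬jump' (Equivalence.to jump⇔ jump))
... | no ¬jump | yes jump' = ⊥-elim (¬jump (Equivalence.from jump⇔ jump'))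

-- As for L0, the summand of jumps is local to its definition.
jumps-summands : ∀ m a → Σ (ℕ → ℕ) λ F → jumps m a ≡ sum (map F (upTo (m ℕ.∸ 1)))
jumps-summands m a = _ , refl

jumps≡sum : ∀ m a → jumps m a ≡ sum (applyUpTo (λ i → jumpAt a (suc i)) (m ℕ.∸ 1))
jumps≡sum m a = trans (proj₂ (jumps-summands m a))
  (cong sum (trans (map-cong summand (upTo (m ℕ.∸ 1))) (map-upTo _ (m ℕ.∸ 1))))
  where
  summand : ∀ i → proj₁ (jumps-summands m a) i ≡ jumpAt a (suc i)
  summand i with a (suc i) ℕ.<? a (suc (suc i))
  ... | yes _ = refl
  ... | no _ = refl

sum-symmetric-even : ∀ r (f : ℕ → ℕ) → (∀ {i} → i ℕ.< r ℕ.* 2 → f i ≡ f (r ℕ.* 2 ℕ.∸ suc i)) →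
  2 ∣ℕ sum (applyUpTo f (r ℕ.* 2))
sum-symmetric-even zero f _ = 2 ℕDiv.∣0
sum-symmetric-even (suc r) f symm =
  subst (2 ∣ℕ_) (sym split) (ℕDiv.∣m∣n⇒∣m+n (sum-symmetric-even r (f ∘ suc) symm-inner) (ℕDiv.n∣m*n (f 0)))
  where
  k : ℕ
  k = r ℕ.* 2
  symm-inner : ∀ {i} → i ℕ.< k → f (suc i) ≡ f (suc (k ℕ.∸ suc i))
  symm-inner i<k = trans (symm (s≤s (ℕP.m≤n⇒m≤1+n i<k))) (cong f (ℕP.+-∸-assoc 1 i<k))
  regroup : ∀ x s → x ℕ.+ (s ℕ.+ (x ℕ.+ 0)) ≡ s ℕ.+ x ℕ.* 2
  regroup = ℕSolver.solve-∀
  split : sum (applyUpTo f (suc (suc k))) ≡ sum (applyUpTo (f ∘ suc) k) ℕ.+ f 0 ℕ.* 2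
  split = begin
    f 0 ℕ.+ sum (applyUpTo (f ∘ suc) (suc k))
      ≡⟨ cong (λ xs → f 0 ℕ.+ sum xs) (applyUpTo-∷ʳ (f ∘ suc) k) ⟨
    f 0 ℕ.+ sum (applyUpTo (f ∘ suc) k ∷ʳ f (suc k))
      ≡⟨ cong (f 0 ℕ.+_) (sum-++ (applyUpTo (f ∘ suc) k) (f (suc k) ∷ [])) ⟩
    f 0 ℕ.+ (sum (applyUpTo (f ∘ suc) k) ℕ.+ (f (suc k) ℕ.+ 0))
      ≡⟨ cong (λ x → f 0 ℕ.+ (sum (applyUpTo (f ∘ suc) k) ℕ.+ (x ℕ.+ 0))) (symm (s≤s z≤n)) ⟨
    f 0 ℕ.+ (sum (applyUpTo (f ∘ suc) k) ℕ.+ (f 0 ℕ.+ 0))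
      ≡⟨ regroup (f 0) _ ⟩
    sum (applyUpTo (f ∘ suc) k) ℕ.+ f 0 ℕ.* 2 ∎
    where open ≡-Reasoning

-- Criticality rules out coinciding weights

∈-⊗⁺ : ∀ {ρ σ : WRep} {c d e} → c ∈ ρ → d ∈ σ → e ∈ (c ⊗c d) → e ∈ (ρ ⊗ σ)
∈-⊗⁺ {ρ} {σ} {c} c∈ρ d∈σ e∈c⊗d =
  ∈-concatMap⁺ (λ c → concatMap (c ⊗c_) σ) (lose c∈ρ (∈-concatMap⁺ (c ⊗c_) (lose d∈σ e∈c⊗d)))

two∈piW : ∀ n w l δ {i} → 1 ℕ.≤ i → 2 ℕ.* i ℕ.≤ n → two (l i) (- w) ∈ piW n w l δ
two∈piW n w l δ {suc i} _ 2i≤n = ∈-++⁺ˡ (∈-map⁺ (λ i → two (l (suc i)) (- w)) (∈-upTo⁺ i<n/2))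
  where
  i<n/2 : i ℕ.< n ℕ./ 2
  i<n/2 = subst (ℕ._≤ n ℕ./ 2) (ℕD.m*n/n≡m (suc i) 2) (ℕD./-monoˡ-≤ 2 (subst (ℕ._≤ n) (ℕP.*-comm 2 (suc i)) 2i≤n))

sgn∈two⊗two : ∀ ε {k k'} A B → k ≡ k' → one ε (A + B) ∈ (two k A ⊗c two k' B)
sgn∈two⊗two ε {k} {k'} A B k≡k' with k ℤ.≟ k'
... | no k≢k' = ⊥-elim (k≢k' k≡k')
sgn∈two⊗two zeroF A B _ | yes _ = there (here refl)
sgn∈two⊗two (sucF zeroF) A B _ | yes _ = there (there (here refl))

module _ (S T : ℤ) where
  private
    -4* : ∀ k → - (+ 4 * + k) ≡ - (+ (4 ℕ.* k))
    -4* k = cong -_ (sym (ℤP.pos-* 4 k))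

    pole : ∀ ε k → T + S + + (2 ℕ.* toℕ ε) ≡ - (+ 4 * + k) → PoleC (one ε S) T
    pole ε k eq = k , trans eq (-4* k)

    dual-pole : ∀ ε k → + 2 - (T + S) + + (2 ℕ.* toℕ ε) ≡ - (+ 4 * + k) → PoleC (dualC (one ε S)) (+ 2 - T)
    dual-pole ε k eq = k , trans (cong (_+ + (2 ℕ.* toℕ ε)) (dual-shape T S)) (trans eq (-4* k))
      where dual-shape : ∀ T S → + 2 - T + - S ≡ + 2 - (T + S)
            dual-shape = solve-∀

    halves : ∀ {z} r q → T + S ≡ z * + 2 → z ≡ + r + q * + 2 → T + S ≡ (+ r + q * + 2) * + 2
    halves r q T+S≡2z z≡ = trans T+S≡2z (cong (_* + 2) z≡)

  -- Γ_R(s) Γ_R(s + 1) has a pole at every integer s ≤ 0, so the characters sgn⁰ and sgn¹ at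
  -- the same integral t give a pole of L(s) or of L(1 - s, dual) at every integral s.
  sgn-pair-pole : ∀ z → T + S ≡ z * + 2 →
    ∃ λ ε → PoleC (one ε S) T ⊎ PoleC (dualC (one ε S)) (+ 2 - T)
  sgn-pair-pole z T+S≡2z
    with z ℤD.% + 2 | z ℤD./ + 2 | ℤD.a≡a%n+[a/n]*n z (+ 2) | ℤD.n%d<d z (+ 2)
  ... | 0 | + zero | z≡ | _ = zeroF , inj₁ (pole zeroF 0 (trans (cong (_+ + 0) (halves 0 (+ 0) T+S≡2z z≡)) refl))
  ... | 0 | + suc k | z≡ | _ = sucF zeroF , inj₂ (dual-pole (sucF zeroF) k
                                   (trans (cong (λ y → + 2 - y + + 2) (halves 0 (+ suc k) T+S≡2z z≡)) (even-positive (+ k))))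
    where even-positive : ∀ k → + 2 - (+ 0 + (+ 1 + k) * + 2) * + 2 + + 2 ≡ - (+ 4 * k)
          even-positive = solve-∀
  ... | 0 | -[1+ k ] | z≡ | _ = zeroF , inj₁ (pole zeroF (suc k)
                                   (trans (cong (_+ + 0) (halves 0 -[1+ k ] T+S≡2z z≡)) (even-negative (+ k))))
    where even-negative : ∀ k → (+ 0 + - (+ 1 + k) * + 2) * + 2 + + 0 ≡ - (+ 4 * (+ 1 + k))
          even-negative = solve-∀
  ... | 1 | + k | z≡ | _ = zeroF , inj₂ (dual-pole zeroF k
                                   (trans (cong (λ y → + 2 - y + + 0) (halves 1 (+ k) T+S≡2z z≡)) (odd-nonNegative (+ k))))
    where odd-nonNegative : ∀ k → + 2 - (+ 1 + k * + 2) * + 2 + + 0 ≡ - (+ 4 * k)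
          odd-nonNegative = solve-∀
  ... | 1 | -[1+ k ] | z≡ | _ = sucF zeroF , inj₁ (pole (sucF zeroF) k
                                   (trans (cong (_+ + 2) (halves 1 -[1+ k ] T+S≡2z z≡)) (odd-negative (+ k))))
    where odd-negative : ∀ k → (+ 1 + - (+ 1 + k) * + 2) * + 2 + + 2 ≡ - (+ 4 * k)
          odd-negative = solve-∀
  ... | suc (suc _) | _ | _ | s≤s (s≤s ())

coinciding-weights⇒¬critical : ∀ {n m w l w' l'} (δ δ' : Fin 2) → InL0+ n w l → InL0+ m w' l' →
  ∀ {i j} → 1 ℕ.≤ i → 2 ℕ.* i ℕ.≤ n → 1 ℕ.≤ j → 2 ℕ.* j ℕ.≤ m → l i ≡ l' j →
  ¬ (∃ λ T → Critical n m (piW n w l δ ⊗ piW m w' l' δ') T)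
coinciding-weights⇒¬critical {n} {m} {w} {l} {w'} {l'} δ δ' H H' {i} {j} 1≤i 2i≤n 1≤j 2j≤m li≡l'j
  (T , 2∣T-n-m , ¬pole , ¬dual-pole) = refute (sgn-pair-pole S T (c - q - q' + l i - + 1) T+S-even)
  where
  S : ℤ
  S = - w + - w'
  sgn∈τ : ∀ ε → one ε S ∈ (piW n w l δ ⊗ piW m w' l' δ')
  sgn∈τ ε = ∈-⊗⁺ (two∈piW n w l δ 1≤i 2i≤n) (two∈piW m w' l' δ' 1≤j 2j≤m) (sgn∈two⊗two ε (- w) (- w') li≡l'j)
  refute : (∃ λ ε → PoleC (one ε S) T ⊎ PoleC (dualC (one ε S)) (+ 2 - T)) → ⊥
  refute (ε , inj₁ pole) = ¬pole (lose (sgn∈τ ε) pole)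
  refute (ε , inj₂ pole) = ¬dual-pole (lose (∈-map⁺ dualC (sgn∈τ ε)) pole)
  2∣ᵤT-n-m : + 2 ℤDiv.∣ (T - + (n ℕ.+ m))
  2∣ᵤT-n-m = ℤDiv.∣ᵤ⇒∣ 2∣T-n-m
  c q q' : ℤ
  c = ℤDiv._∣_.quotient 2∣ᵤT-n-m
  i-parity : Σ ℤ λ q → w + l i - + suc n ≡ q * + 2
  i-parity = L0⁺.weight-parity H 1≤i (ℕP.≤-trans (ℕP.m≤m+n i _) 2i≤n)
  j-parity : Σ ℤ λ q → w' + l' j - + suc m ≡ q * + 2
  j-parity = L0⁺.weight-parity H' 1≤j (ℕP.≤-trans (ℕP.m≤m+n j _) 2j≤m)
  q = proj₁ i-parity
  q' = proj₁ j-parity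
  regroup : ∀ T w w' l l' n m →
    T + (- w + - w') ≡ (T - (n + m)) - (w + l - (+ 1 + n)) - (w' + l' - (+ 1 + m)) + l + l' - + 2
  regroup = solve-∀
  collect : ∀ c q q' l → c * + 2 - q * + 2 - q' * + 2 + l + l - + 2 ≡ (c - q - q' + l - + 1) * + 2
  collect = solve-∀
  T+S-even : T + S ≡ (c - q - q' + l i - + 1) * + 2
  T+S-even = begin
    T + S
      ≡⟨ regroup T w w' (l i) (l' j) (+ n) (+ m) ⟩
    (T - (+ n + + m)) - (w + l i - (+ 1 + + n)) - (w' + l' j - (+ 1 + + m)) + l i + l' j - + 2
      ≡⟨ cong₂ (λ x y → x - (w + l i - (+ 1 + + n)) - (w' + l' j - (+ 1 + + m)) + l i + y - + 2)
               (trans (cong (λ k → T - k) (sym (ℤP.pos-+ n m))) (ℤDiv._∣_.equality 2∣ᵤT-n-m))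
               (sym li≡l'j) ⟩
    c * + 2 - (w + l i - (+ 1 + + n)) - (w' + l' j - (+ 1 + + m)) + l i + l i - + 2
      ≡⟨ cong₂ (λ x y → c * + 2 - x - y + l i + l i - + 2)
               (proj₂ i-parity) (proj₂ j-parity) ⟩
    c * + 2 - q * + 2 - q' * + 2 + l i + l i - + 2
      ≡⟨ collect c q q' (l i) ⟩
    (c - q - q' + l i - + 1) * + 2 ∎
    where open ≡-Reasoning

offMiddle-weights-distinct : ∀ {n m w l w' l'} (δ δ' : Fin 2) → InL0+ n w l → InL0+ m w' l' →
  (∃ λ T → Critical n m (piW n w l δ ⊗ piW m w' l' δ') T) →
  ForAllPairs n m (λ i j → l i ≢ l' j)
offMiddle-weights-distinct {n} {m} δ δ' H H' critical {i} {j} (1≤i , i≤n) (1≤j , j≤m) ¬mid li≡l'j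
  with ℕP.<-cmp (2 ℕ.* i) (suc n) | ℕP.<-cmp (2 ℕ.* j) (suc m)
... | tri< 2i≤n _ _ | tri< 2j≤m _ _ =
  coinciding-weights⇒¬critical δ δ' H H' 1≤i (ℕP.≤-pred 2i≤n) 1≤j (ℕP.≤-pred 2j≤m) li≡l'j critical
... | tri> _ _ n<2i | tri> _ _ m<2j =
  coinciding-weights⇒¬critical δ δ' H H' (Hₙ.1≤mirror i≤n) (Hₙ.2*mirror≤N {i} n<2i) (Hₘ.1≤mirror j≤m) (Hₘ.2*mirror≤N {j} m<2j)
    (trans (Hₙ.l-mirror 1≤i i≤n) (trans (cong -_ li≡l'j) (sym (Hₘ.l-mirror 1≤j j≤m)))) critical
  where module Hₙ = L0⁺ H
        module Hₘ = L0⁺ H'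
... | tri≈ _ 2i≡n+1 _ | tri≈ _ 2j≡m+1 _ = ¬mid (2i≡n+1 , 2j≡m+1)
... | tri< 2i≤n _ _ | tri≈ _ 2j≡m+1 _ =
  ℤP.<-irrefl (sym (trans li≡l'j (L0⁺.l≡0 H' 2j≡m+1))) (L0⁺.0<l H 1≤i (ℕP.≤-pred 2i≤n))
... | tri< 2i≤n _ _ | tri> _ _ m<2j =
  ℤP.<-asym (subst (_< 0ℤ) (sym li≡l'j) (L0⁺.l<0 H' j≤m m<2j)) (L0⁺.0<l H 1≤i (ℕP.≤-pred 2i≤n))
... | tri≈ _ 2i≡n+1 _ | tri< 2j≤m _ _ =
  ℤP.<-irrefl (trans (sym (L0⁺.l≡0 H 2i≡n+1)) li≡l'j) (L0⁺.0<l H' 1≤j (ℕP.≤-pred 2j≤m))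
... | tri≈ _ 2i≡n+1 _ | tri> _ _ m<2j =
  ℤP.<-irrefl (trans (sym li≡l'j) (L0⁺.l≡0 H 2i≡n+1)) (L0⁺.l<0 H' j≤m m<2j)
... | tri> _ _ n<2i | tri< 2j≤m _ _ =
  ℤP.<-asym (subst (_< 0ℤ) li≡l'j (L0⁺.l<0 H i≤n n<2i)) (L0⁺.0<l H' 1≤j (ℕP.≤-pred 2j≤m))
... | tri> _ _ n<2i | tri≈ _ 2j≡m+1 _ =
  ℤP.<-irrefl (trans li≡l'j (L0⁺.l≡0 H' 2j≡m+1)) (L0⁺.l<0 H i≤n n<2i)

∣x∣≤k⇔ : ∀ x k → (∣ x ∣ ℕ.≤ k) ⇔ ((- + k ≤ x) × (x ≤ + k))
∣x∣≤k⇔ x k = mk⇔ (bounds x k) (bounded x k)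
  where
  bounds : ∀ x k → ∣ x ∣ ℕ.≤ k → (- + k ≤ x) × (x ≤ + k)
  bounds (+ p) k p≤k = ℤP.neg-≤-pos , +≤+ p≤k
  bounds -[1+ p ] (suc k) (s≤s p≤k) = -≤- p≤k , -≤+
  bounded : ∀ x k → (- + k ≤ x) × (x ≤ + k) → ∣ x ∣ ℕ.≤ k
  bounded (+ p) k (_ , +≤+ p≤k) = p≤k
  bounded -[1+ p ] (suc k) (-≤- p≤k , _) = s≤s p≤k

∣x∣≤∣d∣⇔ : ∀ x d {c} → + ∣ d ∣ ≡ c → (∣ x ∣ ℕ.≤ ∣ d ∣) ⇔ ((- c ≤ x) × (x ≤ c))
∣x∣≤∣d∣⇔ x d refl = ∣x∣≤k⇔ x ∣ d ∣

+∣i-j∣≡i-j : ∀ {i j} → j ≤ i → + ∣ i - j ∣ ≡ i - j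
+∣i-j∣≡i-j j≤i = ℤP.0≤i⇒+∣i∣≡i (ℤP.i≤j⇒0≤j-i j≤i)

+∣i-j∣≡j-i : ∀ {i j} → i ≤ j → + ∣ i - j ∣ ≡ j - i
+∣i-j∣≡j-i {i} {j} i≤j = begin
  + ∣ i - j ∣     ≡⟨ cong +_ (ℤP.∣i-j∣≡∣j-i∣ i j) ⟩
  + ∣ j - i ∣     ≡⟨ +∣i-j∣≡i-j i≤j ⟩
  j - i           ∎
  where open ≡-Reasoning

i-j≤i-k : ∀ i {j k} → k ≤ j → i - j ≤ i - k
i-j≤i-k i k≤j = ℤP.+-monoʳ-≤ i (ℤP.neg-mono-≤ k≤j)

i-k≤j-k : ∀ {i j} k → i ≤ j → i - k ≤ j - k
i-k≤j-k k i≤j = ℤP.+-monoˡ-≤ (- k) i≤j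

-[i-j]≡j-i : ∀ i j → - (i - j) ≡ j - i
-[i-j]≡j-i = solve-∀

2*i≡N+1⇒odd : ∀ i N → 2 ℕ.* i ≡ suc N → N ℕ.% 2 ≡ 1
2*i≡N+1⇒odd zero N ()
2*i≡N+1⇒odd (suc i) N 2i≡N+1 = trans (cong (ℕ._% 2) (sym N≡)) (ℕD.[m+kn]%n≡m%n 1 i 2)
  where
  shape : ∀ i → 1 ℕ.+ i ℕ.* 2 ≡ i ℕ.+ suc (i ℕ.+ 0)
  shape = ℕSolver.solve-∀
  N≡ : 1 ℕ.+ i ℕ.* 2 ≡ N
  N≡ = trans (shape i) (ℕP.suc-injective 2i≡N+1)

module OddIndex {N k : ℕ} (N≡ : N ≡ suc (k ℕ.* 2)) where

  2*[k+1]≡N+1 : 2 ℕ.* suc k ≡ suc N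
  2*[k+1]≡N+1 = trans (shape k) (cong suc (sym N≡))
    where shape : ∀ k → 2 ℕ.* suc k ≡ suc (suc (k ℕ.* 2))
          shape = ℕSolver.solve-∀

  middle-unique : ∀ {i} → 2 ℕ.* i ≡ suc N → i ≡ suc k
  middle-unique {i} 2i≡ = ℕP.*-cancelˡ-≡ i (suc k) 2 (trans 2i≡ (sym 2*[k+1]≡N+1))

  [N+1]/2≡k+1 : (N ℕ.+ 1) ℕ./ 2 ≡ suc k
  [N+1]/2≡k+1 = trans (cong (λ x → (x ℕ.+ 1) ℕ./ 2) N≡) (trans (cong (ℕ._/ 2) (shape k)) (ℕD.m*n/n≡m (suc k) 2))
    where shape : ∀ k → suc (k ℕ.* 2) ℕ.+ 1 ≡ suc k ℕ.* 2
          shape = ℕSolver.solve-∀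

  [N∸1]/2≡k : (N ℕ.∸ 1) ℕ./ 2 ≡ k
  [N∸1]/2≡k = trans (cong (λ x → (x ℕ.∸ 1) ℕ./ 2) N≡) (ℕD.m*n/n≡m k 2)

  [N+3]/2≡k+2 : (N ℕ.+ 3) ℕ./ 2 ≡ suc (suc k)
  [N+3]/2≡k+2 = trans (cong (λ x → (x ℕ.+ 3) ℕ./ 2) N≡) (trans (cong (ℕ._/ 2) (shape k)) (ℕD.m*n/n≡m (suc (suc k)) 2))
    where shape : ∀ k → suc (k ℕ.* 2) ℕ.+ 3 ≡ suc (suc k) ℕ.* 2
          shape = ℕSolver.solve-∀

  N+1∸k≡k+2 : suc N ℕ.∸ k ≡ suc (suc k)
  N+1∸k≡k+2 = trans (cong (λ x → suc x ℕ.∸ k) N≡) (trans (cong (ℕ._∸ k) (shape k)) (ℕP.m+n∸m≡n k (suc (suc k))))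
    where shape : ∀ k → suc (suc (k ℕ.* 2)) ≡ k ℕ.+ suc (suc k)
          shape = ℕSolver.solve-∀

  N∸k≡k+1 : N ℕ.∸ k ≡ suc k
  N∸k≡k+1 = trans (cong (ℕ._∸ k) N≡) (trans (cong (ℕ._∸ k) (shape k)) (ℕP.m+n∸m≡n k (suc k)))
    where shape : ∀ k → suc (k ℕ.* 2) ≡ k ℕ.+ suc k
          shape = ℕSolver.solve-∀

  N∸[k+1]≡k : N ℕ.∸ suc k ≡ k
  N∸[k+1]≡k = trans (cong (ℕ._∸ suc k) N≡) (trans (cong (ℕ._∸ k) (shape k)) (ℕP.m+n∸m≡n k k))
    where shape : ∀ k → k ℕ.* 2 ≡ k ℕ.+ k
          shape = ℕSolver.solve-∀

  k<N : k ℕ.< N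
  k<N = subst (k ℕ.<_) (sym N≡) (s≤s (ℕP.m≤m*n k 2))

  2k≤N : 2 ℕ.* k ℕ.≤ N
  2k≤N = subst (2 ℕ.* k ℕ.≤_) (sym N≡) (ℕP.≤-trans (ℕP.≤-reflexive (ℕP.*-comm 2 k)) (ℕP.n≤1+n _))

module Hypotheses
  {n m : ℕ} {w : ℤ} {l : ℕ → ℤ} {w' : ℤ} {l' : ℕ → ℤ} {δ δ' : Fin 2}
  (1≤n : 1 ℕ.≤ n) (1≤m : 1 ℕ.≤ m) (H : InL0+ n w l) (H' : InL0+ m w' l')
  (critical : ∃ λ T → Critical n m (piW n w l δ ⊗ piW m w' l' δ') T)
  {a : ℕ → ℕ} (position : IsPositionTuple n m l l' a)
  {T s : ℤ} (2s≡ : + 2 * s ≡ T + + n - + m - + 2)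
  where

  module Hₙ = L0⁺ H
  module Hₘ = L0⁺ H'

  X : ℤ
  X = T - (w + w' + + 1)

  1≤a : ∀ {j} → InRange m j → 1 ℕ.≤ a j
  1≤a (1≤j , j≤m) = proj₁ (position _ 1≤j j≤m)

  a<n : ∀ {j} → InRange m j → a j ℕ.< n
  a<n (1≤j , j≤m) = subst (suc _ ℕ.≤_) (sym (ℕP.+-∸-assoc 1 1≤n)) (s≤s (proj₁ (proj₂ (position _ 1≤j j≤m))))

  a≤n : ∀ {j} → InRange m j → a j ℕ.≤ n
  a≤n j∈ = ℕP.<⇒≤ (a<n j∈)

  l'<l[a] : ∀ {j} → InRange m j → l' j < l (a j)
  l'<l[a] (1≤j , j≤m) = proj₁ (proj₂ (proj₂ (position _ 1≤j j≤m)))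

  l[a+1]≤l' : ∀ {j} → InRange m j → l (suc (a j)) ≤ l' j
  l[a+1]≤l' (1≤j , j≤m) = proj₂ (proj₂ (proj₂ (position _ 1≤j j≤m)))

  a∈ : ∀ {j} → InRange m j → InRange n (a j)
  a∈ j∈ = 1≤a j∈ , a≤n j∈

  a+1∈ : ∀ {j} → InRange m j → InRange n (suc (a j))
  a+1∈ j∈ = s≤s z≤n , a<n j∈

  2≤n : 2 ℕ.≤ n
  2≤n = ℕP.≤-trans (s≤s (1≤a 1∈)) (a<n 1∈)
    where 1∈ = (ℕP.≤-refl , 1≤m)

  mirror∈ : ∀ {j} → InRange m j → InRange m (Hₘ.mirror j)
  mirror∈ (1≤j , j≤m) = Hₘ.1≤mirror j≤m , Hₘ.mirror≤N 1≤j

  weights-distinct : ForAllPairs n m (λ i j → l i ≢ l' j)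
  weights-distinct = offMiddle-weights-distinct δ δ' H H' critical

  double-λ : ∀ {j} → InRange m j → + 2 * λ' n m w' l' a j ≡ w' + l' j - + 1 - + m + + 2 * + a j
  double-λ {j} (1≤j , j≤m) = begin
    + 2 * (ν m w' l' j + + a j - + j)
      ≡⟨ distrib (ν m w' l' j) (+ a j) (+ j) ⟩
    + 2 * ν m w' l' j + + 2 * + a j - + 2 * + j
      ≡⟨ cong (λ x → x + + 2 * + a j - + 2 * + j) (Hₘ.double-μ 1≤j j≤m) ⟩
    w' + l' j + + 2 * + j - + 1 - + m + + 2 * + a j - + 2 * + j
      ≡⟨ cancel w' (l' j) (+ j) (+ m) (+ a j) ⟩
    w' + l' j - + 1 - + m + + 2 * + a j ∎
    where
    open ≡-Reasoning
    distrib : ∀ v a j → + 2 * (v + a - j) ≡ + 2 * v + + 2 * a - + 2 * j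
    distrib = solve-∀
    cancel : ∀ w l j m a → w + l + + 2 * j - + 1 - m + + 2 * a - + 2 * j ≡ w + l - + 1 - m + + 2 * a
    cancel = solve-∀

  double-gap : ∀ {i j} → InRange n i → InRange m j →
    + 2 * (μˇ n w l i - (λ' n m w' l' a j - s)) ≡ l i - l' j + + 2 * + i - + 2 * + a j + X - + 1
  double-gap {i} {j} (1≤i , i≤n) j∈ = begin
    + 2 * (μˇ n w l i - (λ' n m w' l' a j - s))
      ≡⟨ distrib (μˇ n w l i) (λ' n m w' l' a j) s ⟩
    + 2 * μˇ n w l i - + 2 * λ' n m w' l' a j + + 2 * s
      ≡⟨ cong₂ (λ x y → x - y + + 2 * s) (Hₙ.double-μˇ 1≤i i≤n) (double-λ j∈) ⟩
    (l i - w - + n - + 1 + + 2 * + i) - (w' + l' j - + 1 - + m + + 2 * + a j) + + 2 * s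
      ≡⟨ cong (λ x → (l i - w - + n - + 1 + + 2 * + i) - (w' + l' j - + 1 - + m + + 2 * + a j) + x) 2s≡ ⟩
    (l i - w - + n - + 1 + + 2 * + i) - (w' + l' j - + 1 - + m + + 2 * + a j) + (T + + n - + m - + 2)
      ≡⟨ simplify (l i) (l' j) w w' (+ n) (+ m) (+ i) (+ a j) T ⟩
    l i - l' j + + 2 * + i - + 2 * + a j + X - + 1 ∎
    where
    open ≡-Reasoning
    distrib : ∀ u v s → + 2 * (u - (v - s)) ≡ + 2 * u - + 2 * v + + 2 * s
    distrib = solve-∀
    simplify : ∀ l l' w w' n m i a T →
      (l - w - n - + 1 + + 2 * i) - (w' + l' - + 1 - m + + 2 * a) + (T + n - m - + 2)
        ≡ l - l' + + 2 * i - + 2 * a + (T - (w + w' + + 1)) - + 1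
    simplify = solve-∀

  Bracketed : ℕ → Set
  Bracketed j = (l' j - l (a j) < X) × (X < l' j - l (suc (a j)))

  I⇔Bracketed : ∀ {j} → InRange m j → I n m w l w' l' a s j ⇔ Bracketed j
  I⇔Bracketed {j} j∈ = lower⇔ ×-⇔ upper⇔
    where
    gap : ℤ
    gap = λ' n m w' l' a j - s
    lower⇔ : (gap ≤ μˇ n w l (a j)) ⇔ (l' j - l (a j) < X)
    lower⇔ = ≤⇔<-halving gap (μˇ n w l (a j)) (l' j - l (a j)) X
      (trans (double-gap (a∈ j∈) j∈) (simplify (l (a j)) (l' j) (+ a j) X))
      where simplify : ∀ l l' a X → l - l' + + 2 * a - + 2 * a + X - + 1 ≡ X - (l' - l) - + 1
            simplify = solve-∀
    upper⇔ : (μˇ n w l (suc (a j)) ≤ gap) ⇔ (X < l' j - l (suc (a j)))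
    upper⇔ = ≤⇔<-halving (μˇ n w l (suc (a j))) gap X (l' j - l (suc (a j)))
      (trans (negate gap (μˇ n w l (suc (a j))))
             (trans (cong -_ (double-gap (a+1∈ j∈) j∈)) (simplify (l (suc (a j))) (l' j) (+ a j) X)))
      where negate : ∀ g u → + 2 * (g - u) ≡ - (+ 2 * (u - g))
            negate = solve-∀
            simplify : ∀ l l' a X → - (l - l' + + 2 * (+ 1 + a) - + 2 * a + X - + 1) ≡ (l' - l) - X - + 1
            simplify = solve-∀

  X+l-l'-odd : ∀ {i j} → InRange n i → InRange m j → Σ ℤ λ k → X + l i - l' j ≡ k * + 2 + + 1
  X+l-l'-odd {i} {j} (1≤i , i≤n) (1≤j , j≤m) = s - q - q' + l i - + n - + 1 , (begin
    X + l i - l' j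
      ≡⟨ regroup T w w' (l i) (l' j) (+ n) (+ m) ⟩
    (T + + n - + m - + 2) - (w + l i - (+ 1 + + n)) - (w' + l' j - (+ 1 + + m)) + l i + l i - + n - + n - + 1
      ≡⟨ cong₂ (λ x y → x - y - (w' + l' j - (+ 1 + + m)) + l i + l i - + n - + n - + 1) (sym 2s≡) (proj₂ i-parity) ⟩
    + 2 * s - q * + 2 - (w' + l' j - (+ 1 + + m)) + l i + l i - + n - + n - + 1
      ≡⟨ cong (λ y → + 2 * s - q * + 2 - y + l i + l i - + n - + n - + 1) (proj₂ j-parity) ⟩
    + 2 * s - q * + 2 - q' * + 2 + l i + l i - + n - + n - + 1
      ≡⟨ collect s q q' (l i) (+ n) ⟩
    (s - q - q' + l i - + n - + 1) * + 2 + + 1 ∎)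
    where
    open ≡-Reasoning
    i-parity : Σ ℤ λ q → w + l i - + suc n ≡ q * + 2
    i-parity = Hₙ.weight-parity 1≤i i≤n
    j-parity : Σ ℤ λ q → w' + l' j - + suc m ≡ q * + 2
    j-parity = Hₘ.weight-parity 1≤j j≤m
    q q' : ℤ
    q = proj₁ i-parity
    q' = proj₁ j-parity
    regroup : ∀ T w w' l l' n m → T - (w + w' + + 1) + l - l' ≡
      (T + n - m - + 2) - (w + l - (+ 1 + n)) - (w' + l' - (+ 1 + m)) + l + l - n - n - + 1
    regroup = solve-∀
    collect : ∀ s q q' l n → + 2 * s - q * + 2 - q' * + 2 + l + l - n - n - + 1 ≡ (s - q - q' + l - n - + 1) * + 2 + + 1
    collect = solve-∀

  X≢l-l' : ∀ {i j} → InRange n i → InRange m j → X ≢ l i - l' j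
  X≢l-l' {i} {j} i∈ j∈ X≡ = odd≢even (l i - l' j) (proj₁ odd)
    (trans (double (l i) (l' j)) (trans (cong (λ x → x + l i - l' j) (sym X≡)) (proj₂ odd)))
    where odd : Σ ℤ λ k → X + l i - l' j ≡ k * + 2 + + 1
          odd = X+l-l'-odd i∈ j∈
          double : ∀ l l' → (l - l') * + 2 ≡ (l - l') + l - l'
          double = solve-∀

  X≢l'-l : ∀ {i j} → InRange n i → InRange m j → X ≢ l' j - l i
  X≢l'-l {i} {j} i∈ j∈ X≡ = odd≢even 0ℤ (proj₁ odd)
    (trans (cancel (l i) (l' j)) (trans (cong (λ x → x + l i - l' j) (sym X≡)) (proj₂ odd)))
    where odd : Σ ℤ λ k → X + l i - l' j ≡ k * + 2 + + 1
          odd = X+l-l'-odd i∈ j∈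
          cancel : ∀ l l' → 0ℤ * + 2 ≡ (l' - l) + l - l'
          cancel = solve-∀

  -- strict, because X ± (l_i - l'_j) is odd
  ∣X∣≤∣l-l'∣⇒ : ∀ {i j} → InRange n i → InRange m j → ∀ {c} → + ∣ l i - l' j ∣ ≡ c →
    ∣ X ∣ ℕ.≤ ∣ l i - l' j ∣ → (- c < X) × (X < c)
  ∣X∣≤∣l-l'∣⇒ {i} {j} i∈ j∈ {c} ∣l-l'∣≡c ∣X∣≤ =
    ℤP.≤∧≢⇒< (proj₁ bounds) (λ -c≡X → ≢± (sym -c≡X) (-c≡± c≡±)) , ℤP.≤∧≢⇒< (proj₂ bounds) (λ X≡c → ≢± X≡c c≡±)
    where
    bounds : (- c ≤ X) × (X ≤ c)
    bounds = Equivalence.to (∣x∣≤∣d∣⇔ X (l i - l' j) ∣l-l'∣≡c) ∣X∣≤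
    ≢± : ∀ {x} → X ≡ x → x ≡ l i - l' j ⊎ x ≡ l' j - l i → ⊥
    ≢± X≡x (inj₁ refl) = X≢l-l' i∈ j∈ X≡x
    ≢± X≡x (inj₂ refl) = X≢l'-l i∈ j∈ X≡x
    c≡± : c ≡ l i - l' j ⊎ c ≡ l' j - l i
    c≡± with ℤP.≤-total (l' j) (l i)
    ... | inj₁ l'≤l = inj₁ (trans (sym ∣l-l'∣≡c) (+∣i-j∣≡i-j l'≤l))
    ... | inj₂ l≤l' = inj₂ (trans (sym ∣l-l'∣≡c) (+∣i-j∣≡j-i l≤l'))
    -c≡± : ∀ {c} → c ≡ l i - l' j ⊎ c ≡ l' j - l i → - c ≡ l i - l' j ⊎ - c ≡ l' j - l i
    -c≡± (inj₁ refl) = inj₂ (-[i-j]≡j-i (l i) (l' j))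
    -c≡± (inj₂ refl) = inj₁ (-[i-j]≡j-i (l' j) (l i))

  bracket-from-column : ∀ {j} → InRange m j →
    ∣ X ∣ ℕ.≤ ∣ l (a j) - l' j ∣ → ∣ X ∣ ℕ.≤ ∣ l (suc (a j)) - l' j ∣ → Bracketed j
  bracket-from-column {j} j∈ ∣X∣≤₁ ∣X∣≤₂ =
    subst (_< X) (-[i-j]≡j-i (l (a j)) (l' j))
      (proj₁ (∣X∣≤∣l-l'∣⇒ (a∈ j∈) j∈ (+∣i-j∣≡i-j (ℤP.<⇒≤ (l'<l[a] j∈))) ∣X∣≤₁)) ,
    proj₂ (∣X∣≤∣l-l'∣⇒ (a+1∈ j∈) j∈ (+∣i-j∣≡j-i (l[a+1]≤l' j∈)) ∣X∣≤₂)

  a-mirror : ∀ {j} → InRange m j → l' j ≢ l (suc (a j)) → a (Hₘ.mirror j) ≡ n ℕ.∸ a j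
  a-mirror {j} j∈@(1≤j , j≤m) l'≢l =
    Hₙ.position-unique (l' (Hₘ.mirror j)) (1≤a mj∈) (a<n mj∈) (Hₙ.1≤mirror (a<n j∈)) n-a<n
      (l'<l[a] mj∈) (l[a+1]≤l' mj∈) l'[mj]<l[n-a] l[n-a+1]≤l'[mj]
    where
    mj∈ : InRange m (Hₘ.mirror j)
    mj∈ = mirror∈ j∈
    n-a<n : suc (n ℕ.∸ a j) ℕ.≤ n
    n-a<n = subst (ℕ._≤ n) (Hₙ.mirror-suc (a≤n j∈)) (Hₙ.mirror≤N (1≤a j∈))
    l'[mj]<l[n-a] : l' (Hₘ.mirror j) < l (n ℕ.∸ a j)
    l'[mj]<l[n-a] = subst₂ _<_ (sym (Hₘ.l-mirror 1≤j j≤m)) (sym (Hₙ.l-mirror (s≤s z≤n) (a<n j∈)))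
      (ℤP.neg-mono-< (ℤP.≤∧≢⇒< (l[a+1]≤l' j∈) (λ l≡l' → l'≢l (sym l≡l'))))
    l[n-a+1]≤l'[mj] : l (suc (n ℕ.∸ a j)) ≤ l' (Hₘ.mirror j)
    l[n-a+1]≤l'[mj] = subst₂ _≤_
      (trans (sym (Hₙ.l-mirror (1≤a j∈) (a≤n j∈))) (cong l (Hₙ.mirror-suc (a≤n j∈))))
      (sym (Hₘ.l-mirror 1≤j j≤m))
      (ℤP.neg-mono-≤ (ℤP.<⇒≤ (l'<l[a] j∈)))

  -- Bracketed (mirror j), read in column j
  mirror-bracket : ∀ {j} → InRange m j → a (Hₘ.mirror j) ≡ n ℕ.∸ a j → Bracketed (Hₘ.mirror j) →
    (l (suc (a j)) - l' j < X) × (X < l (a j) - l' j)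
  mirror-bracket {j} j∈@(1≤j , j≤m) a[mj]≡ (lower , upper) =
    subst (_< X) (-x--y≡y-x (l' j) (l (suc (a j)))) (subst₂ (λ x y → x - y < X) l'[mj]≡ l[a[mj]]≡ lower) ,
    subst (X <_) (-x--y≡y-x (l' j) (l (a j))) (subst₂ (λ x y → X < x - y) l'[mj]≡ l[a[mj]+1]≡ upper)
    where
    -x--y≡y-x : ∀ x y → - x - - y ≡ y - x
    -x--y≡y-x = solve-∀
    l'[mj]≡ : l' (Hₘ.mirror j) ≡ - l' j
    l'[mj]≡ = Hₘ.l-mirror 1≤j j≤m
    l[a[mj]]≡ : l (a (Hₘ.mirror j)) ≡ - l (suc (a j))
    l[a[mj]]≡ = trans (cong l a[mj]≡) (Hₙ.l-mirror (s≤s z≤n) (a<n j∈))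
    l[a[mj]+1]≡ : l (suc (a (Hₘ.mirror j))) ≡ - l (a j)
    l[a[mj]+1]≡ = trans (cong (λ k → l (suc k)) a[mj]≡)
                   (trans (cong l (sym (Hₙ.mirror-suc (a≤n j∈)))) (Hₙ.l-mirror (1≤a j∈) (a≤n j∈)))

  -- the bounds on X from columns j and mirror j reach every l_i, on either side of l'_j
  column-bounded : ∀ {j} → InRange m j → Bracketed j → (l (suc (a j)) - l' j < X) × (X < l (a j) - l' j) →
    ∀ {i} → InRange n i → ∣ X ∣ ℕ.≤ ∣ l i - l' j ∣
  column-bounded {j} j∈ (lower , upper) (lower' , upper') {i} (1≤i , i≤n) with i ℕ.≤? a j
  ... | yes i≤a = Equivalence.from (∣x∣≤∣d∣⇔ X (l i - l' j) (+∣i-j∣≡i-j l'≤l)) (-c≤X , X≤c)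
    where
    open ℤP.≤-Reasoning
    l[a]≤l : l (a j) ≤ l i
    l[a]≤l = Hₙ.decreasing-≤ 1≤i i≤a (a≤n j∈)
    l'≤l : l' j ≤ l i
    l'≤l = ℤP.≤-trans (ℤP.<⇒≤ (l'<l[a] j∈)) l[a]≤l
    -c≤X : - (l i - l' j) ≤ X
    -c≤X = begin
      - (l i - l' j)   ≡⟨ -[i-j]≡j-i (l i) (l' j) ⟩
      l' j - l i       ≤⟨ i-j≤i-k (l' j) l[a]≤l ⟩
      l' j - l (a j)   <⟨ lower ⟩
      X                ∎
    X≤c : X ≤ l i - l' j
    X≤c = begin
      X                <⟨ upper' ⟩
      l (a j) - l' j   ≤⟨ i-k≤j-k (l' j) l[a]≤l ⟩
      l i - l' j       ∎
  ... | no i≰a = Equivalence.from (∣x∣≤∣d∣⇔ X (l i - l' j) (+∣i-j∣≡j-i l≤l')) (-c≤X , X≤c)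
    where
    open ℤP.≤-Reasoning
    l≤l[a+1] : l i ≤ l (suc (a j))
    l≤l[a+1] = Hₙ.decreasing-≤ (s≤s z≤n) (ℕP.≰⇒> i≰a) i≤n
    l≤l' : l i ≤ l' j
    l≤l' = ℤP.≤-trans l≤l[a+1] (l[a+1]≤l' j∈)
    -c≤X : - (l' j - l i) ≤ X
    -c≤X = begin
      - (l' j - l i)         ≡⟨ -[i-j]≡j-i (l' j) (l i) ⟩
      l i - l' j             ≤⟨ i-k≤j-k (l' j) l≤l[a+1] ⟩
      l (suc (a j)) - l' j   <⟨ lower' ⟩
      X                      ∎
    X≤c : X ≤ l' j - l i
    X≤c = begin
      X                      <⟨ upper ⟩
      l' j - l (suc (a j))   ≤⟨ i-j≤i-k (l' j) l≤l[a+1] ⟩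
      l' j - l i             ∎

  column-bounded-by-I : ∀ {j} → InRange m j → ¬ isMiddle n m (suc (a j)) j →
    I n m w l w' l' a s j → I n m w l w' l' a s (Hₘ.mirror j) →
    ∀ {i} → InRange n i → ∣ X ∣ ℕ.≤ ∣ l i - l' j ∣
  column-bounded-by-I j∈ ¬mid Iⱼ I[mj] = column-bounded j∈ (Equivalence.to (I⇔Bracketed j∈) Iⱼ)
    (mirror-bracket j∈ (a-mirror j∈ (λ l'≡l → weights-distinct (a+1∈ j∈) j∈ ¬mid (sym l'≡l)))
                       (Equivalence.to (I⇔Bracketed (mirror∈ j∈)) I[mj]))

  I-by-column : ∀ {j} → InRange m j →
    ∣ X ∣ ℕ.≤ ∣ l (a j) - l' j ∣ → ∣ X ∣ ℕ.≤ ∣ l (suc (a j)) - l' j ∣ → I n m w l w' l' a s j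
  I-by-column j∈ ∣X∣≤₁ ∣X∣≤₂ = Equivalence.from (I⇔Bracketed j∈) (bracket-from-column j∈ ∣X∣≤₁ ∣X∣≤₂)

  ∣X∣<L0+1⇔ : (∣ X ∣ ℕ.< L0 n m l l' ℕ.+ 1) ⇔ ForAllPairs n m (λ i j → ∣ X ∣ ℕ.≤ ∣ l i - l' j ∣)
  ∣X∣<L0+1⇔ = mk⇔ pairs-bounded bounded-pairs
    where
    ∣X∣≤L0⇔ : (∣ X ∣ ℕ.≤ L0 n m l l') ⇔ ForAllPairs n m (λ i j → ∣ X ∣ ℕ.≤ ∣ l i - l' j ∣)
    ∣X∣≤L0⇔ = ≤L0⇔ n m l l' (ℕP.≤-refl , 1≤n) (ℕP.≤-refl , 1≤m)
                (λ (2≡n+1 , _) → ℕP.<-irrefl (ℕP.suc-injective 2≡n+1) 2≤n)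
    pairs-bounded : ∣ X ∣ ℕ.< L0 n m l l' ℕ.+ 1 → ForAllPairs n m (λ i j → ∣ X ∣ ℕ.≤ ∣ l i - l' j ∣)
    pairs-bounded ∣X∣< = Equivalence.to ∣X∣≤L0⇔ (ℕP.m<1+n⇒m≤n (subst (∣ X ∣ ℕ.<_) (ℕP.+-comm _ 1) ∣X∣<))
    bounded-pairs : ForAllPairs n m (λ i j → ∣ X ∣ ℕ.≤ ∣ l i - l' j ∣) → ∣ X ∣ ℕ.< L0 n m l l' ℕ.+ 1
    bounded-pairs ∣X∣≤ = subst (∣ X ∣ ℕ.<_) (ℕP.+-comm 1 _) (s≤s (Equivalence.from ∣X∣≤L0⇔ ∣X∣≤))

  notBothOdd : ¬ ((n ℕ.% 2 ≡ 1) × (m ℕ.% 2 ≡ 1)) →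
    (∣ X ∣ ℕ.< L0 n m l l' ℕ.+ 1 ⇔ (∀ j → 1 ℕ.≤ j → j ℕ.≤ m → I n m w l w' l' a s j))
  notBothOdd ¬odd = mk⇔ allI allBounded
    where
    ¬mid : ∀ i j → ¬ isMiddle n m i j
    ¬mid i j (2i≡n+1 , 2j≡m+1) = ¬odd (2*i≡N+1⇒odd i n 2i≡n+1 , 2*i≡N+1⇒odd j m 2j≡m+1)
    allI : ∣ X ∣ ℕ.< L0 n m l l' ℕ.+ 1 → ∀ j → 1 ℕ.≤ j → j ℕ.≤ m → I n m w l w' l' a s j
    allI ∣X∣< j 1≤j j≤m = I-by-column j∈ (bounded (a∈ j∈) j∈ (¬mid (a j) j)) (bounded (a+1∈ j∈) j∈ (¬mid (suc (a j)) j))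
      where
      j∈ : InRange m j
      j∈ = (1≤j , j≤m)
      bounded : ForAllPairs n m (λ i j → ∣ X ∣ ℕ.≤ ∣ l i - l' j ∣)
      bounded = Equivalence.to ∣X∣<L0+1⇔ ∣X∣<
    allBounded : (∀ j → 1 ℕ.≤ j → j ℕ.≤ m → I n m w l w' l' a s j) → ∣ X ∣ ℕ.< L0 n m l l' ℕ.+ 1
    allBounded allI = Equivalence.from ∣X∣<L0+1⇔ λ {_} {j} i∈ j∈ _ →
      column-bounded-by-I j∈ (¬mid (suc (a j)) j) (allI _ (proj₁ j∈) (proj₂ j∈)) (allI _ (proj₁ (mirror∈ j∈)) (proj₂ (mirror∈ j∈))) i∈

  jump-mirror : ∀ {j} → 1 ℕ.≤ j → suc j ℕ.≤ m →
    ¬ isMiddle n m (suc (a j)) j → ¬ isMiddle n m (suc (a (suc j))) (suc j) →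
    (a j ℕ.< a (suc j)) ⇔ (a (m ℕ.∸ j) ℕ.< a (suc (m ℕ.∸ j)))
  jump-mirror {j} 1≤j j<m ¬mid ¬mid' = mk⇔
    (λ jump → subst₂ ℕ._<_ (sym a[m-j]≡) (sym a[m-j+1]≡) (ℕP.∸-monoʳ-< jump (a≤n j+1∈)))
    (λ jump → ℕP.∸-cancelʳ-< (subst₂ ℕ._<_ a[m-j]≡ a[m-j+1]≡ jump))
    where
    j∈ : InRange m j
    j∈ = 1≤j , ℕP.<⇒≤ j<m
    j+1∈ : InRange m (suc j)
    j+1∈ = s≤s z≤n , j<m
    avoid : ∀ {k} → (k∈ : InRange m k) → ¬ isMiddle n m (suc (a k)) k → l' k ≢ l (suc (a k))
    avoid k∈ ¬mid l'≡l = weights-distinct (a+1∈ k∈) k∈ ¬mid (sym l'≡l)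
    a[m-j]≡ : a (m ℕ.∸ j) ≡ n ℕ.∸ a (suc j)
    a[m-j]≡ = a-mirror j+1∈ (avoid j+1∈ ¬mid')
    a[m-j+1]≡ : a (suc (m ℕ.∸ j)) ≡ n ℕ.∸ a j
    a[m-j+1]≡ = trans (cong a (sym (Hₘ.mirror-suc (proj₂ j∈)))) (a-mirror j∈ (avoid j∈ ¬mid))

  module BothOdd (n-odd : n ℕ.% 2 ≡ 1) (m-odd : m ℕ.% 2 ≡ 1) where

    h g : ℕ
    h = n ℕ./ 2
    g = m ℕ./ 2

    n≡ : n ≡ suc (h ℕ.* 2)
    n≡ = trans (ℕD.m≡m%n+[m/n]*n n 2) (cong (ℕ._+ h ℕ.* 2) n-odd)

    m≡ : m ≡ suc (g ℕ.* 2)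
    m≡ = trans (ℕD.m≡m%n+[m/n]*n m 2) (cong (ℕ._+ g ℕ.* 2) m-odd)

    module Iₙ = OddIndex {k = h} n≡
    module Iₘ = OddIndex {k = g} m≡

    1≤h : 1 ℕ.≤ h
    1≤h with h | n≡
    ... | zero | refl = ⊥-elim (ℕP.<-irrefl refl 2≤n)
    ... | suc _ | _ = s≤s z≤n

    h∈ : InRange n h
    h∈ = 1≤h , ℕP.<⇒≤ Iₙ.k<N

    h+2∈ : InRange n (suc (suc h))
    h+2∈ = subst (InRange n) Iₙ.N+1∸k≡k+2 (Hₙ.1≤mirror (proj₂ h∈) , Hₙ.mirror≤N 1≤h)

    h+1∈ : InRange n (suc h)
    h+1∈ = s≤s z≤n , ℕP.<⇒≤ (proj₂ h+2∈)

    g+1∈ : InRange m (suc g)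
    g+1∈ = s≤s z≤n , Iₘ.k<N

    l[h+1]≡0 : l (suc h) ≡ 0ℤ
    l[h+1]≡0 = Hₙ.l≡0 Iₙ.2*[k+1]≡N+1

    l'[g+1]≡0 : l' (suc g) ≡ 0ℤ
    l'[g+1]≡0 = Hₘ.l≡0 Iₘ.2*[k+1]≡N+1

    0<l[h] : 0ℤ < l h
    0<l[h] = Hₙ.0<l 1≤h Iₙ.2k≤N

    l[h+2]≡-l[h] : l (suc (suc h)) ≡ - l h
    l[h+2]≡-l[h] = trans (cong l (sym Iₙ.N+1∸k≡k+2)) (Hₙ.l-mirror 1≤h (proj₂ h∈))

    a[g+1]≡h : a (suc g) ≡ h
    a[g+1]≡h = Hₙ.position-unique 0ℤ (1≤a g+1∈) (a<n g+1∈) 1≤h (proj₂ h+1∈)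
      (subst (_< l (a (suc g))) l'[g+1]≡0 (l'<l[a] g+1∈))
      (subst₂ _≤_ refl l'[g+1]≡0 (l[a+1]≤l' g+1∈))
      0<l[h] (ℤP.≤-reflexive l[h+1]≡0)

    ¬isMiddle : ∀ i j → (i ≢ suc h ⊎ j ≢ suc g) → ¬ isMiddle n m i j
    ¬isMiddle i j (inj₁ i≢) (2i≡ , _) = i≢ (Iₙ.middle-unique 2i≡)
    ¬isMiddle i j (inj₂ j≢) (_ , 2j≡) = j≢ (Iₘ.middle-unique 2j≡)

    Even : Set
    Even = 2 ∣ℕ jumps m a

    MiddleEven : Set
    MiddleEven = (λ' n m w' l' a (suc g) - s ≤ μˇ n w l h)
               × (μˇ n w l (suc (suc h)) - + 1 ≤ λ' n m w' l' a (suc g) - s)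

    MiddleOdd : Set
    MiddleOdd = (μˇ n w l (suc h) + s ≤ λ' n m w' l' a g)
              × (λ' n m w' l' a (suc (suc g)) ≤ μˇ n w l (suc h) + s)

    Middle≡ : Middle n m w l w' l' a s ≡ ((Even → MiddleEven) × (¬ Even → MiddleOdd))
    Middle≡ = middleAt Iₘ.[N+1]/2≡k+1 Iₙ.[N∸1]/2≡k Iₙ.[N+3]/2≡k+2 Iₙ.[N+1]/2≡k+1 Iₘ.[N∸1]/2≡k Iₘ.[N+3]/2≡k+2
      where
      MiddleAt : (j₀ i₋ i₊ i₀ j₋ j₊ : ℕ) → Set
      MiddleAt j₀ i₋ i₊ i₀ j₋ j₊ =
        (Even → (λ' n m w' l' a j₀ - s ≤ μˇ n w l i₋) × (μˇ n w l i₊ - + 1 ≤ λ' n m w' l' a j₀ - s))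
        × (¬ Even → (μˇ n w l i₀ + s ≤ λ' n m w' l' a j₋) × (λ' n m w' l' a j₊ ≤ μˇ n w l i₀ + s))
      middleAt : ∀ {j₀ i₋ i₊ i₀ j₋ j₊ j₀' i₋' i₊' i₀' j₋' j₊'} →
        j₀ ≡ j₀' → i₋ ≡ i₋' → i₊ ≡ i₊' → i₀ ≡ i₀' → j₋ ≡ j₋' → j₊ ≡ j₊' →
        MiddleAt j₀ i₋ i₊ i₀ j₋ j₊ ≡ MiddleAt j₀' i₋' i₊' i₀' j₋' j₊'
      middleAt refl refl refl refl refl refl = refl

    MiddleEven⇔ : MiddleEven ⇔ ((- l h < X) × (X < l h))
    MiddleEven⇔ = ≤⇔<-halving gap (μˇ n w l h) (- l h) X lower
             ×-⇔ ≤⇔<-halving (μˇ n w l (suc (suc h)) - + 1) gap X (l h) upper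
      where
      gap : ℤ
      gap = λ' n m w' l' a (suc g) - s
      lower : + 2 * (μˇ n w l h - gap) ≡ X - - l h - + 1
      lower = trans (double-gap h∈ g+1∈)
        (trans (cong₂ (λ y k → l h - y + + 2 * + h - + 2 * + k + X - + 1) l'[g+1]≡0 a[g+1]≡h)
               (simplify (l h) (+ h) X))
        where simplify : ∀ l h X → l - 0ℤ + + 2 * h - + 2 * h + X - + 1 ≡ X - - l - + 1
              simplify = solve-∀
      upper : + 2 * (gap - (μˇ n w l (suc (suc h)) - + 1)) ≡ l h - X - + 1
      upper = trans (negate gap (μˇ n w l (suc (suc h))))
        (trans (cong (λ x → - x + + 2) (double-gap h+2∈ g+1∈))
        (trans (cong₂ (λ x y → - (x - y + + 2 * (+ 2 + + h) - + 2 * + a (suc g) + X - + 1) + + 2) l[h+2]≡-l[h] l'[g+1]≡0)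
        (trans (cong (λ k → - (- l h - 0ℤ + + 2 * (+ 2 + + h) - + 2 * + k + X - + 1) + + 2) a[g+1]≡h)
               (simplify (l h) (+ h) X))))
        where negate : ∀ u v → + 2 * (u - (v - + 1)) ≡ - (+ 2 * (v - u)) + + 2
              negate = solve-∀
              simplify : ∀ l h X → - (- l - 0ℤ + + 2 * (+ 2 + h) - + 2 * h + X - + 1) + + 2 ≡ l - X - + 1
              simplify = solve-∀

    g∈ : 1 ℕ.≤ g → InRange m g
    g∈ 1≤g = 1≤g , ℕP.<⇒≤ Iₘ.k<N

    0<l'[g] : 1 ℕ.≤ g → 0ℤ < l' g
    0<l'[g] 1≤g = Hₘ.0<l 1≤g Iₘ.2k≤N

    a[g+2]≡n-a[g] : 1 ℕ.≤ g → a (suc (suc g)) ≡ n ℕ.∸ a g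
    a[g+2]≡n-a[g] 1≤g = trans (cong a (sym Iₘ.N+1∸k≡k+2))
      (a-mirror (g∈ 1≤g) (λ l'≡l → weights-distinct (a+1∈ (g∈ 1≤g)) (g∈ 1≤g)
                                      (¬isMiddle (suc (a g)) g (inj₂ (ℕP.<⇒≢ (ℕP.n<1+n g)))) (sym l'≡l)))

    MiddleOdd⇔ : 1 ℕ.≤ g → a g ≡ h → MiddleOdd ⇔ ((X < l' g) × (- l' g < X))
    MiddleOdd⇔ 1≤g a[g]≡h = ≤⇔<-halving (μˇ n w l (suc h) + s) (λ' n m w' l' a g) X (l' g) upper
                       ×-⇔ ≤⇔<-halving (λ' n m w' l' a (suc (suc g))) (μˇ n w l (suc h) + s) (- l' g) X lower
      where
      a[g+2]≡h+1 : a (suc (suc g)) ≡ suc h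
      a[g+2]≡h+1 = trans (a[g+2]≡n-a[g] 1≤g) (trans (cong (n ℕ.∸_) a[g]≡h) Iₙ.N∸k≡k+1)
      l'[g+2]≡-l'[g] : l' (suc (suc g)) ≡ - l' g
      l'[g+2]≡-l'[g] = trans (cong l' (sym Iₘ.N+1∸k≡k+2)) (Hₘ.l-mirror 1≤g (proj₂ (g∈ 1≤g)))
      upper : + 2 * (λ' n m w' l' a g - (μˇ n w l (suc h) + s)) ≡ l' g - X - + 1
      upper = trans (negate (λ' n m w' l' a g) (μˇ n w l (suc h)) s)
        (trans (cong -_ (double-gap h+1∈ (g∈ 1≤g)))
        (trans (cong₂ (λ x k → - (x - l' g + + 2 * (+ 1 + + h) - + 2 * + k + X - + 1)) l[h+1]≡0 a[g]≡h)
               (simplify (l' g) (+ h) X)))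
        where negate : ∀ v u s → + 2 * (v - (u + s)) ≡ - (+ 2 * (u - (v - s)))
              negate = solve-∀
              simplify : ∀ l' h X → - (0ℤ - l' + + 2 * (+ 1 + h) - + 2 * h + X - + 1) ≡ l' - X - + 1
              simplify = solve-∀
      lower : + 2 * ((μˇ n w l (suc h) + s) - λ' n m w' l' a (suc (suc g))) ≡ X - - l' g - + 1
      lower = trans (regroup (λ' n m w' l' a (suc (suc g))) (μˇ n w l (suc h)) s)
        (trans (double-gap h+1∈ (subst (InRange m) Iₘ.N+1∸k≡k+2 (mirror∈ (g∈ 1≤g))))
        (trans (cong₂ (λ x y → x - y + + 2 * (+ 1 + + h) - + 2 * + a (suc (suc g)) + X - + 1) l[h+1]≡0 l'[g+2]≡-l'[g])
        (trans (cong (λ k → 0ℤ - - l' g + + 2 * (+ 1 + + h) - + 2 * + k + X - + 1) a[g+2]≡h+1)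
               (simplify (l' g) (+ h) X))))
        where regroup : ∀ v u s → + 2 * ((u + s) - v) ≡ + 2 * (u - (v - s))
              regroup = solve-∀
              simplify : ∀ l' h X → 0ℤ - - l' + + 2 * (+ 1 + h) - + 2 * (+ 1 + h) + X - + 1 ≡ X - - l' - + 1
              simplify = solve-∀

    a[g]≤h : 1 ℕ.≤ g → a g ℕ.≤ h
    a[g]≤h 1≤g = ℕP.≮⇒≥ λ h<a[g] → ℤP.<-asym (0<l'[g] 1≤g)
      (ℤP.<-≤-trans (l'<l[a] (g∈ 1≤g))
        (ℤP.≤-trans (Hₙ.decreasing-≤ (s≤s z≤n) h<a[g] (a≤n (g∈ 1≤g))) (ℤP.≤-reflexive l[h+1]≡0)))

    jumps-around-middle : 1 ℕ.≤ g → a g ℕ.< h → (a g ℕ.< a (suc g)) × (a (suc g) ℕ.< a (suc (suc g)))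
    jumps-around-middle 1≤g a[g]<h =
      subst (a g ℕ.<_) (sym a[g+1]≡h) a[g]<h ,
      subst₂ ℕ._<_ (sym a[g+1]≡h) (sym (a[g+2]≡n-a[g] 1≤g))
        (ℕP.<-trans (ℕP.n<1+n h) (subst (ℕ._< n ℕ.∸ a g) Iₙ.N∸k≡k+1 (ℕP.∸-monoʳ-< a[g]<h (proj₂ h∈))))

    JumpsSymmetric : Set
    JumpsSymmetric = ∀ {j} → 1 ℕ.≤ j → suc j ℕ.≤ m → jumpAt a j ≡ jumpAt a (m ℕ.∸ j)

    jumps-symmetric : (g ≡ 0) ⊎ ((1 ℕ.≤ g) × (a g ℕ.< h)) → JumpsSymmetric
    jumps-symmetric (inj₁ g≡0) {suc j} _ j<m
      with subst (suc (suc j) ℕ.≤_) (trans m≡ (cong (λ k → suc (k ℕ.* 2)) g≡0)) j<m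
    ... | s≤s ()
    jumps-symmetric (inj₂ (1≤g , a[g]<h)) {j} 1≤j j<m with j ℕ.≟ g | j ℕ.≟ suc g
    ... | yes refl | _ = trans (jumpAt-yes a g (proj₁ both))
        (trans (sym (jumpAt-yes a (suc g) (proj₂ both))) (cong (jumpAt a) (sym Iₘ.N∸k≡k+1)))
      where both : (a g ℕ.< a (suc g)) × (a (suc g) ℕ.< a (suc (suc g)))
            both = jumps-around-middle 1≤g a[g]<h
    ... | _ | yes refl = trans (jumpAt-yes a (suc g) (proj₂ both))
        (trans (sym (jumpAt-yes a g (proj₁ both))) (cong (jumpAt a) (sym Iₘ.N∸[k+1]≡k)))
      where both : (a g ℕ.< a (suc g)) × (a (suc g) ℕ.< a (suc (suc g)))
            both = jumps-around-middle 1≤g a[g]<h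
    ... | no j≢g | no j≢g+1 = jumpAt-cong a j (m ℕ.∸ j) (jump-mirror 1≤j j<m
        (¬isMiddle (suc (a j)) j (inj₂ j≢g+1)) (¬isMiddle (suc (a (suc j))) (suc j) (inj₂ (λ j+1≡ → j≢g (ℕP.suc-injective j+1≡)))))

    even-if-symmetric : JumpsSymmetric → Even
    even-if-symmetric symm = subst (2 ∣ℕ_) (sym jumps≡) (sum-symmetric-even g f f-symm)
      where
      f : ℕ → ℕ
      f i = jumpAt a (suc i)
      jumps≡ : jumps m a ≡ sum (applyUpTo f (g ℕ.* 2))
      jumps≡ = trans (jumps≡sum m a) (cong (λ k → sum (applyUpTo f (k ℕ.∸ 1))) m≡)
      f-symm : ∀ {i} → i ℕ.< g ℕ.* 2 → f i ≡ f (g ℕ.* 2 ℕ.∸ suc i)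
      f-symm {i} i<2g = trans (symm (s≤s z≤n) (subst (suc (suc i) ℕ.≤_) (sym m≡) (s≤s i<2g)))
        (cong (jumpAt a) (trans (cong (ℕ._∸ suc i) m≡) (ℕP.+-∸-assoc 1 i<2g)))

    odd-jumps⇒a[g]≡h : ¬ Even → (1 ℕ.≤ g) × (a g ≡ h)
    odd-jumps⇒a[g]≡h ¬even with g ℕ.≟ 0
    ... | yes g≡0 = ⊥-elim (¬even (even-if-symmetric (jumps-symmetric (inj₁ g≡0))))
    ... | no g≢0 = 1≤g , ℕP.≤-antisym (a[g]≤h 1≤g)
          (ℕP.≮⇒≥ λ a[g]<h → ¬even (even-if-symmetric (jumps-symmetric (inj₂ (1≤g , a[g]<h)))))
      where 1≤g = ℕP.n≢0⇒n>0 g≢0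

    middle-column-bounded : - l h < X → X < l h → ∀ {i} → InRange n i → i ≢ suc h →
      ∣ X ∣ ℕ.≤ ∣ l i - l' (suc g) ∣
    middle-column-bounded -l[h]<X X<l[h] {i} (1≤i , i≤n) i≢h+1 =
      subst (λ y → ∣ X ∣ ℕ.≤ ∣ l i - y ∣) (sym l'[g+1]≡0) (bounded (i ℕ.≤? h))
      where
      open ℤP.≤-Reasoning
      bounded : Dec (i ℕ.≤ h) → ∣ X ∣ ℕ.≤ ∣ l i - 0ℤ ∣
      bounded (yes i≤h) = Equivalence.from (∣x∣≤∣d∣⇔ X (l i - 0ℤ) (+∣i-j∣≡i-j 0≤l)) (-c≤X , X≤c)
        where
        l[h]≤l : l h ≤ l i
        l[h]≤l = Hₙ.decreasing-≤ 1≤i i≤h (proj₂ h∈)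
        0≤l : 0ℤ ≤ l i
        0≤l = ℤP.≤-trans (ℤP.<⇒≤ 0<l[h]) l[h]≤l
        -c≤X : - (l i - 0ℤ) ≤ X
        -c≤X = begin
          - (l i - 0ℤ)   ≡⟨ cong -_ (ℤP.+-identityʳ (l i)) ⟩
          - l i          ≤⟨ ℤP.neg-mono-≤ l[h]≤l ⟩
          - l h          <⟨ -l[h]<X ⟩
          X              ∎
        X≤c : X ≤ l i - 0ℤ
        X≤c = begin
          X              <⟨ X<l[h] ⟩
          l h            ≤⟨ l[h]≤l ⟩
          l i            ≡⟨ ℤP.+-identityʳ (l i) ⟨
          l i - 0ℤ       ∎
      bounded (no i≰h) = Equivalence.from (∣x∣≤∣d∣⇔ X (l i - 0ℤ) (+∣i-j∣≡j-i l≤0)) (-c≤X , X≤c)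
        where
        l≤-l[h] : l i ≤ - l h
        l≤-l[h] = subst (l i ≤_) l[h+2]≡-l[h]
          (Hₙ.decreasing-≤ (s≤s z≤n) (ℕP.≤∧≢⇒< (ℕP.≰⇒> i≰h) (λ h+1≡i → i≢h+1 (sym h+1≡i))) i≤n)
        l≤0 : l i ≤ 0ℤ
        l≤0 = ℤP.≤-trans l≤-l[h] (ℤP.neg-mono-≤ (ℤP.<⇒≤ 0<l[h]))
        -c≤X : - (0ℤ - l i) ≤ X
        -c≤X = begin
          - (0ℤ - l i)   ≡⟨ -[i-j]≡j-i 0ℤ (l i) ⟩
          l i - 0ℤ       ≡⟨ ℤP.+-identityʳ (l i) ⟩
          l i            ≤⟨ l≤-l[h] ⟩
          - l h          <⟨ -l[h]<X ⟩
          X              ∎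
        X≤c : X ≤ 0ℤ - l i
        X≤c = begin
          X              <⟨ X<l[h] ⟩
          l h            ≡⟨ ℤP.neg-involutive (l h) ⟨
          - - l h        ≤⟨ ℤP.neg-mono-≤ l≤-l[h] ⟩
          - l i          ≡⟨ ℤP.+-identityˡ (- l i) ⟨
          0ℤ - l i       ∎

    OffMiddleI : Set
    OffMiddleI = ∀ j → 1 ℕ.≤ j → j ℕ.≤ m → j ≢ (m ℕ.+ 1) ℕ./ 2 → I n m w l w' l' a s j

    bothOdd : ∣ X ∣ ℕ.< L0 n m l l' ℕ.+ 1 ⇔ (OffMiddleI × Middle n m w l w' l' a s)
    bothOdd = mk⇔ conditions bounded
      where
      conditions : ∣ X ∣ ℕ.< L0 n m l l' ℕ.+ 1 → OffMiddleI × Middle n m w l w' l' a s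
      conditions ∣X∣< = offMiddle , subst (λ P → P) (sym Middle≡) (even , odd)
        where
        ∣X∣≤ : ForAllPairs n m (λ i j → ∣ X ∣ ℕ.≤ ∣ l i - l' j ∣)
        ∣X∣≤ = Equivalence.to ∣X∣<L0+1⇔ ∣X∣<
        offMiddle : OffMiddleI
        offMiddle j 1≤j j≤m j≢ = I-by-column (1≤j , j≤m)
          (∣X∣≤ (a∈ (1≤j , j≤m)) (1≤j , j≤m) (¬isMiddle (a j) j (inj₂ j≢g+1)))
          (∣X∣≤ (a+1∈ (1≤j , j≤m)) (1≤j , j≤m) (¬isMiddle (suc (a j)) j (inj₂ j≢g+1)))
          where
          j≢g+1 : j ≢ suc g
          j≢g+1 j≡ = j≢ (trans j≡ (sym Iₘ.[N+1]/2≡k+1))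
        even : Even → MiddleEven
        even _ = Equivalence.from MiddleEven⇔ (∣X∣≤∣l-l'∣⇒ h∈ g+1∈ ∣l[h]-l'[g+1]∣≡
          (∣X∣≤ h∈ g+1∈ (¬isMiddle h (suc g) (inj₁ (ℕP.<⇒≢ (ℕP.n<1+n h))))))
          where
          ∣l[h]-l'[g+1]∣≡ : + ∣ l h - l' (suc g) ∣ ≡ l h
          ∣l[h]-l'[g+1]∣≡ = trans (+∣i-j∣≡i-j (subst (_≤ l h) (sym l'[g+1]≡0) (ℤP.<⇒≤ 0<l[h])))
                                  (trans (cong (λ x → l h - x) l'[g+1]≡0) (ℤP.+-identityʳ (l h)))
        odd : ¬ Even → MiddleOdd
        odd ¬even = Equivalence.from (MiddleOdd⇔ 1≤g a[g]≡h)
          (swap (∣X∣≤∣l-l'∣⇒ h+1∈ (g∈ 1≤g) ∣l[h+1]-l'[g]∣≡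
                  (∣X∣≤ h+1∈ (g∈ 1≤g) (¬isMiddle (suc h) g (inj₂ (ℕP.<⇒≢ (ℕP.n<1+n g)))))))
          where
          1≤g : 1 ℕ.≤ g
          1≤g = proj₁ (odd-jumps⇒a[g]≡h ¬even)
          a[g]≡h : a g ≡ h
          a[g]≡h = proj₂ (odd-jumps⇒a[g]≡h ¬even)
          ∣l[h+1]-l'[g]∣≡ : + ∣ l (suc h) - l' g ∣ ≡ l' g
          ∣l[h+1]-l'[g]∣≡ = trans (+∣i-j∣≡j-i (subst (_≤ l' g) (sym l[h+1]≡0) (ℤP.<⇒≤ (0<l'[g] 1≤g))))
                                  (trans (cong (λ x → l' g - x) l[h+1]≡0) (ℤP.+-identityʳ (l' g)))
      bounded : OffMiddleI × Middle n m w l w' l' a s → ∣ X ∣ ℕ.< L0 n m l l' ℕ.+ 1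
      bounded (offMiddle , middle) = Equivalence.from ∣X∣<L0+1⇔ pairs
        where
        middle' : (Even → MiddleEven) × (¬ Even → MiddleOdd)
        middle' = subst (λ P → P) Middle≡ middle
        X-range : Dec Even → (- l h < X) × (X < l h)
        X-range (yes even) = Equivalence.to MiddleEven⇔ (proj₁ middle' even)
        X-range (no ¬even) = ℤP.<-trans (ℤP.neg-mono-< l'[g]<l[h]) (proj₂ X-range') ,
                             ℤP.<-trans (proj₁ X-range') l'[g]<l[h]
          where
          1≤g : 1 ℕ.≤ g
          1≤g = proj₁ (odd-jumps⇒a[g]≡h ¬even)
          a[g]≡h : a g ≡ h
          a[g]≡h = proj₂ (odd-jumps⇒a[g]≡h ¬even)
          X-range' : (X < l' g) × (- l' g < X)
          X-range' = Equivalence.to (MiddleOdd⇔ 1≤g a[g]≡h) (proj₂ middle' ¬even)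
          l'[g]<l[h] : l' g < l h
          l'[g]<l[h] = subst (λ k → l' g < l k) a[g]≡h (l'<l[a] (g∈ 1≤g))
        I-off : ∀ {j} → InRange m j → j ≢ suc g → I n m w l w' l' a s j
        I-off (1≤j , j≤m) j≢ = offMiddle _ 1≤j j≤m (λ j≡ → j≢ (trans j≡ Iₘ.[N+1]/2≡k+1))
        pairs : ForAllPairs n m (λ i j → ∣ X ∣ ℕ.≤ ∣ l i - l' j ∣)
        pairs {i} {j} i∈ j∈ ¬mid = column (j ℕ.≟ suc g)
          where
          column : Dec (j ≡ suc g) → ∣ X ∣ ℕ.≤ ∣ l i - l' j ∣
          column (yes refl) = middle-column-bounded (proj₁ range) (proj₂ range) i∈
                                (λ { refl → ¬mid (Iₙ.2*[k+1]≡N+1 , Iₘ.2*[k+1]≡N+1) })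
            where range : (- l h < X) × (X < l h)
                  range = X-range (2 ℕDiv.∣? jumps m a)
          column (no j≢) = column-bounded-by-I j∈ (¬isMiddle (suc (a j)) j (inj₂ j≢)) (I-off j∈ j≢) (I-off (mirror∈ j∈) mj≢) i∈
            where
            mj≢ : Hₘ.mirror j ≢ suc g
            mj≢ mj≡ = j≢ (trans (sym (Hₘ.mirror-involutive (proj₂ j∈))) (trans (cong Hₘ.mirror mj≡) Iₘ.N∸k≡k+1))

proposition3p2 :
    (n m : ℕ) (w : ℤ) (l : ℕ → ℤ) (w' : ℤ) (l' : ℕ → ℤ) (δ δ' : Fin 2) →
    1 ℕ.≤ n → 1 ℕ.≤ m → InL0+ n w l → InL0+ m w' l' →
    (∃ λ T → Critical n m (piW n w l δ ⊗ piW m w' l' δ') T) →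
    l' 1 ℤ.< l 1 →
    (a : ℕ → ℕ) → IsPositionTuple n m l l' a →
    (T s : ℤ) → + 2 * s ≡ T + + n - + m - + 2 →
    (¬ ((n ℕ.% 2 ≡ 1) × (m ℕ.% 2 ≡ 1)) →
       (∣ T - (w + w' + + 1) ∣ ℕ.< L0 n m l l' ℕ.+ 1
         ⇔ (∀ j → 1 ℕ.≤ j → j ℕ.≤ m → I n m w l w' l' a s j)))
    × ((n ℕ.% 2 ≡ 1) → (m ℕ.% 2 ≡ 1) →
       (∣ T - (w + w' + + 1) ∣ ℕ.< L0 n m l l' ℕ.+ 1
         ⇔ ((∀ j → 1 ℕ.≤ j → j ℕ.≤ m → j ≢ (m ℕ.+ 1) ℕ./ 2 → I n m w l w' l' a s j)
            × Middle n m w l w' l' a s)))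
proposition3p2 n m w l w' l' δ δ' 1≤n 1≤m H H' critical _ a position T s 2s≡ =
  notBothOdd , λ n-odd m-odd → BothOdd.bothOdd n-odd m-odd
  where open Hypotheses 1≤n 1≤m H H' critical position {T} 2s≡
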